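{- Let $k$ be a field and let $A,B\in k[t]$ be coprime monic polynomials. If $F\in k[t]_{\geq0}$ and $\deg F>\deg A+\deg B$, then there exist $x,y\in k[t]_{\geq0}$ such that $F=xA+yB$.
   Context: $k[t]_{\geq 0}$ denotes the set consisting of all monic polynomials in $k[t]$ together with the zero polynomial. -}

module Defs where

open import Level using (Level; _⊔_; suc)
open import Algebra.Bundles using (CommutativeRing)
open import Data.Nat using (ℕ; zero; suc; _<_)
open import Data.List using (List; []; _∷_)
open import Data.Product using (Σ; ∃; ∃-syntax; _×_; _,_)
open import Data.Sum using (_⊎_)
open import Relation.Nullary using (¬_)

record Field (c ℓ : Level) : Set (Level.suc (c ⊔ ℓ)) where
  field
    commutativeRing : CommutativeRing c ℓ
  open CommutativeRing commutativeRing public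
  field
    0#≉1#   : ¬ (0# ≈ 1#)
    inverse : ∀ x → ¬ (x ≈ 0#) → ∃[ y ] (x * y ≈ 1#)

-- Polynomials in k[t] over a field k, as coefficient lists
-- (constant term first), compared up to trailing zeros.
module Poly {c ℓ} (K : Field c ℓ) where
  open Field K

  Pol : Set c
  Pol = List Carrier

  coeff : Pol → ℕ → Carrier
  coeff []       _       = 0#
  coeff (a ∷ p)  zero    = a
  coeff (a ∷ p)  (suc i) = coeff p i

  infix 4 _≈ₚ_
  _≈ₚ_ : Pol → Pol → Set ℓ
  p ≈ₚ q = ∀ i → coeff p i ≈ coeff q i

  infixl 6 _+ₚ_
  _+ₚ_ : Pol → Pol → Pol
  []      +ₚ q       = q
  (a ∷ p) +ₚ []      = a ∷ p
  (a ∷ p) +ₚ (b ∷ q) = (a + b) ∷ (p +ₚ q)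

  scale : Carrier → Pol → Pol
  scale a []      = []
  scale a (b ∷ q) = (a * b) ∷ scale a q

  infixl 7 _*ₚ_
  _*ₚ_ : Pol → Pol → Pol
  []      *ₚ q = []
  (a ∷ p) *ₚ q = scale a q +ₚ (0# ∷ (p *ₚ q))

  1ₚ : Pol
  1ₚ = 1# ∷ []

  0ₚ : Pol
  0ₚ = []

  MonicOfDeg : Pol → ℕ → Set ℓ
  MonicOfDeg p n = (coeff p n ≈ 1#) × (∀ m → n < m → coeff p m ≈ 0#)

  Monic : Pol → Set ℓ
  Monic p = ∃[ n ] MonicOfDeg p n

  InKt≥0 : Pol → Set ℓ
  InKt≥0 p = (p ≈ₚ 0ₚ) ⊎ Monic p

  _∣ₚ_ : Pol → Pol → Set (c ⊔ ℓ)
  d ∣ₚ p = ∃[ q ] (d *ₚ q ≈ₚ p)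

  IsUnit : Pol → Set (c ⊔ ℓ)
  IsUnit u = ∃[ v ] (u *ₚ v ≈ₚ 1ₚ)

  Coprime : Pol → Pol → Set (c ⊔ ℓ)
  Coprime p q = ∀ d → d ∣ₚ p → d ∣ₚ q → IsUnit d

-- Bézout gives F = (uF) A + (vF) B; dividing uF by B leaves F = r A + y₀ B with deg r < b.  Then
-- deg (r A) < a + b < deg F, so y₀ B is monic of degree deg F and y₀ monic of degree deg F − b, and
-- x = B + r, y = y₀ − A are monic with F = x A + y B.
--
-- Equality in k need not be decidable, so Bézout cannot be obtained from the Euclidean algorithm.
-- Classical reasoning is still sound for negative statements: a monic element of least degree in
-- the ideal (A, B) divides A and B, hence is a unit, so ¬¬ Bézout; Bézout makes the Sylvester
-- matrix of A and B injective, so its determinant is not 0.  The inverse of that determinant then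
-- turns Cramer's rule into an explicit Bézout identity.

module Submission where

open import Defs
open import Level using (_⊔_)
open import Algebra.Bundles using (CommutativeRing)
open import Data.Empty using (⊥)
open import Data.Nat using (ℕ; zero; suc; _≤_; _<_; _∸_; z≤n; s≤s; _<?_) renaming (_+_ to _+ℕ_)
open import Data.Nat.Properties
  using (≤-refl; ≤-trans; ≤-reflexive; <⇒≤; ≮⇒≥; n≤1+n; m≤n+m; m≤n⇒m<n∨m≡n; m<n⇒m<1+n; suc-injective; m+n≡0⇒m≡0; m∸n+n≡m; m+n≤o⇒m≤o∸n)
  renaming (+-comm to +ℕ-comm)
open import Data.Nat.Induction using (<-rec)
open import Data.List using (List; []; _∷_; _++_; [_]; map; length; applyUpTo)
open import Data.List.Properties using (++-assoc; ++-identityʳ; map-++; length-map; length-++-sucʳ; length-applyUpTo)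
open import Data.List.Relation.Binary.Pointwise as Pointwise using (Pointwise; []; _∷_)
open import Data.List.Relation.Unary.All as All using (All; []; _∷_)
open import Data.List.Relation.Unary.All.Properties using (++⁺; ++⁻ˡ; ++⁻ʳ; map⁺; map⁻; applyUpTo⁻)
open import Data.List.Relation.Unary.Any using (here; there)
open import Data.List.Membership.Propositional using (_∈_)
open import Data.List.Membership.Propositional.Properties using (∈-∃++; ∈-++⁺ˡ; ∈-++⁺ʳ; ∈-applyUpTo⁺)
open import Data.Product using (∃-syntax; _×_; _,_; proj₁; proj₂)
open import Data.Sum as Sum using (_⊎_; inj₁; inj₂)
open import Function using (_∘_)
open import Relation.Binary.Structures using (IsEquivalence)
open import Relation.Binary.Bundles using (Setoid)
open import Relation.Nullary using (¬_; Dec; yes; no; ¬¬-excluded-middle)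
open import Relation.Nullary.Negation using (contradiction)
import Relation.Binary.PropositionalEquality as ≡
open ≡ using (_≡_)
import Algebra.Properties.AbelianGroup as AbelianGroupProperties
import Algebra.Properties.CommutativeSemigroup as CommutativeSemigroupProperties
import Algebra.Properties.Ring as RingProperties
import Algebra.Solver.Ring.NaturalCoefficients.Default as NaturalCoefficientsSolver
import Relation.Binary.Reasoning.Setoid as SetoidReasoning

module PolynomialRing {c ℓ} (K : Field c ℓ) where
  open Field K
  open Poly K
  open RingProperties ring using (-1*x≈-x)
  open CommutativeSemigroupProperties +-commutativeSemigroup using (interchange; x∙yz≈y∙xz)
  open SetoidReasoning setoid

  -- _≈ₚ_ unfolds to a Π-type over coeff, from which Agda cannot recover the
  -- polynomials; the record restores inference.
  infix 4 _≐_
  record _≐_ (p q : Pol) : Set ℓ where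
    constructor coeffwise
    field coeff-≈ : p ≈ₚ q
  open _≐_ public

  ≐-isEquivalence : IsEquivalence _≐_
  ≐-isEquivalence = record
    { refl  = coeffwise λ _ → refl
    ; sym   = λ p≐q → coeffwise λ i → sym (coeff-≈ p≐q i)
    ; trans = λ p≐q q≐r → coeffwise λ i → trans (coeff-≈ p≐q i) (coeff-≈ q≐r i)
    }

  open IsEquivalence ≐-isEquivalence public
    using () renaming (refl to ≐-refl; sym to ≐-sym; trans to ≐-trans)

  ≐-setoid : Setoid c ℓ
  ≐-setoid = record { isEquivalence = ≐-isEquivalence }

  shift : Pol → Pol
  shift p = 0# ∷ p

  -ₚ_ : Pol → Pol
  -ₚ p = scale (- 1#) p

  coeff-+ₚ : ∀ p q i → coeff (p +ₚ q) i ≈ coeff p i + coeff q i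
  coeff-+ₚ []      q       i       = sym (+-identityˡ _)
  coeff-+ₚ (a ∷ p) []      i       = sym (+-identityʳ _)
  coeff-+ₚ (a ∷ p) (b ∷ q) zero    = refl
  coeff-+ₚ (a ∷ p) (b ∷ q) (suc i) = coeff-+ₚ p q i

  coeff-scale : ∀ a p i → coeff (scale a p) i ≈ a * coeff p i
  coeff-scale a []      i       = sym (zeroʳ a)
  coeff-scale a (b ∷ p) zero    = refl
  coeff-scale a (b ∷ p) (suc i) = coeff-scale a p i

  coeff--ₚ : ∀ p i → coeff (-ₚ p) i ≈ - coeff p i
  coeff--ₚ p i = trans (coeff-scale (- 1#) p i) (-1*x≈-x _)

  coeff-∷*ₚ : ∀ a p q i → coeff ((a ∷ p) *ₚ q) i ≈ a * coeff q i + coeff (shift (p *ₚ q)) i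
  coeff-∷*ₚ a p q i = trans (coeff-+ₚ (scale a q) (shift (p *ₚ q)) i) (+-congʳ (coeff-scale a q i))

  ∷-cong : ∀ {a b p q} → a ≈ b → p ≐ q → a ∷ p ≐ b ∷ q
  ∷-cong a≈b p≐q = coeffwise λ { zero → a≈b ; (suc i) → coeff-≈ p≐q i }

  ∷-injectiveʳ : ∀ {a b p q} → a ∷ p ≐ b ∷ q → p ≐ q
  ∷-injectiveʳ e = coeffwise λ i → coeff-≈ e (suc i)

  shift-cong : ∀ {p q} → p ≐ q → shift p ≐ shift q
  shift-cong = ∷-cong refl

  +ₚ-cong : ∀ {p p′ q q′} → p ≐ p′ → q ≐ q′ → p +ₚ q ≐ p′ +ₚ q′
  +ₚ-cong {p} {p′} {q} {q′} p≐p′ q≐q′ = coeffwise λ i → begin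
    coeff (p +ₚ q) i          ≈⟨ coeff-+ₚ p q i ⟩
    coeff p i + coeff q i     ≈⟨ +-cong (coeff-≈ p≐p′ i) (coeff-≈ q≐q′ i) ⟩
    coeff p′ i + coeff q′ i   ≈⟨ coeff-+ₚ p′ q′ i ⟨
    coeff (p′ +ₚ q′) i        ∎

  scale-cong : ∀ {a b p q} → a ≈ b → p ≐ q → scale a p ≐ scale b q
  scale-cong {a} {b} {p} {q} a≈b p≐q = coeffwise λ i → begin
    coeff (scale a p) i   ≈⟨ coeff-scale a p i ⟩
    a * coeff p i         ≈⟨ *-cong a≈b (coeff-≈ p≐q i) ⟩
    b * coeff q i         ≈⟨ coeff-scale b q i ⟨
    coeff (scale b q) i   ∎

  -ₚ-cong : ∀ {p q} → p ≐ q → -ₚ p ≐ -ₚ q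
  -ₚ-cong = scale-cong refl

  +ₚ-comm : ∀ p q → p +ₚ q ≐ q +ₚ p
  +ₚ-comm p q = coeffwise λ i → begin
    coeff (p +ₚ q) i        ≈⟨ coeff-+ₚ p q i ⟩
    coeff p i + coeff q i   ≈⟨ +-comm _ _ ⟩
    coeff q i + coeff p i   ≈⟨ coeff-+ₚ q p i ⟨
    coeff (q +ₚ p) i        ∎

  +ₚ-assoc : ∀ p q r → (p +ₚ q) +ₚ r ≐ p +ₚ (q +ₚ r)
  +ₚ-assoc p q r = coeffwise λ i → begin
    coeff ((p +ₚ q) +ₚ r) i                ≈⟨ coeff-+ₚ (p +ₚ q) r i ⟩
    coeff (p +ₚ q) i + coeff r i           ≈⟨ +-congʳ (coeff-+ₚ p q i) ⟩
    coeff p i + coeff q i + coeff r i      ≈⟨ +-assoc _ _ _ ⟩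
    coeff p i + (coeff q i + coeff r i)    ≈⟨ +-congˡ (coeff-+ₚ q r i) ⟨
    coeff p i + coeff (q +ₚ r) i           ≈⟨ coeff-+ₚ p (q +ₚ r) i ⟨
    coeff (p +ₚ (q +ₚ r)) i                ∎

  +ₚ-identityʳ : ∀ p → p +ₚ [] ≐ p
  +ₚ-identityʳ []      = ≐-refl
  +ₚ-identityʳ (a ∷ p) = ≐-refl

  +ₚ-interchange : ∀ p q r s → (p +ₚ q) +ₚ (r +ₚ s) ≐ (p +ₚ r) +ₚ (q +ₚ s)
  +ₚ-interchange p q r s = coeffwise λ i → begin
    coeff ((p +ₚ q) +ₚ (r +ₚ s)) i
      ≈⟨ trans (coeff-+ₚ (p +ₚ q) (r +ₚ s) i) (+-cong (coeff-+ₚ p q i) (coeff-+ₚ r s i)) ⟩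
    (coeff p i + coeff q i) + (coeff r i + coeff s i)
      ≈⟨ interchange _ _ _ _ ⟩
    (coeff p i + coeff r i) + (coeff q i + coeff s i)
      ≈⟨ trans (coeff-+ₚ (p +ₚ r) (q +ₚ s) i) (+-cong (coeff-+ₚ p r i) (coeff-+ₚ q s i)) ⟨
    coeff ((p +ₚ r) +ₚ (q +ₚ s)) i ∎

  -ₚ-inverseʳ : ∀ p → p +ₚ -ₚ p ≐ []
  -ₚ-inverseʳ p = coeffwise λ i → begin
    coeff (p +ₚ -ₚ p) i         ≈⟨ coeff-+ₚ p (-ₚ p) i ⟩
    coeff p i + coeff (-ₚ p) i  ≈⟨ +-congˡ (coeff--ₚ p i) ⟩
    coeff p i - coeff p i       ≈⟨ -‿inverseʳ _ ⟩
    0#                          ∎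

  shift-+ₚ : ∀ p q → shift (p +ₚ q) ≐ shift p +ₚ shift q
  shift-+ₚ p q = ∷-cong (sym (+-identityˡ 0#)) ≐-refl

  scale-+ₚ : ∀ a p q → scale a (p +ₚ q) ≐ scale a p +ₚ scale a q
  scale-+ₚ a p q = coeffwise λ i → begin
    coeff (scale a (p +ₚ q)) i                  ≈⟨ coeff-scale a (p +ₚ q) i ⟩
    a * coeff (p +ₚ q) i                        ≈⟨ *-congˡ (coeff-+ₚ p q i) ⟩
    a * (coeff p i + coeff q i)                 ≈⟨ distribˡ a _ _ ⟩
    a * coeff p i + a * coeff q i               ≈⟨ +-cong (coeff-scale a p i) (coeff-scale a q i) ⟨
    coeff (scale a p) i + coeff (scale a q) i   ≈⟨ coeff-+ₚ (scale a p) (scale a q) i ⟨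
    coeff (scale a p +ₚ scale a q) i            ∎

  scale-distribʳ : ∀ a b p → scale (a + b) p ≐ scale a p +ₚ scale b p
  scale-distribʳ a b p = coeffwise λ i → begin
    coeff (scale (a + b) p) i                   ≈⟨ coeff-scale (a + b) p i ⟩
    (a + b) * coeff p i                         ≈⟨ distribʳ _ a b ⟩
    a * coeff p i + b * coeff p i               ≈⟨ +-cong (coeff-scale a p i) (coeff-scale b p i) ⟨
    coeff (scale a p) i + coeff (scale b p) i   ≈⟨ coeff-+ₚ (scale a p) (scale b p) i ⟨
    coeff (scale a p +ₚ scale b p) i            ∎

  scale-scale : ∀ a b p → scale a (scale b p) ≐ scale (a * b) p
  scale-scale a b p = coeffwise λ i → begin
    coeff (scale a (scale b p)) i   ≈⟨ coeff-scale a (scale b p) i ⟩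
    a * coeff (scale b p) i         ≈⟨ *-congˡ (coeff-scale b p i) ⟩
    a * (b * coeff p i)             ≈⟨ *-assoc a b _ ⟨
    a * b * coeff p i               ≈⟨ coeff-scale (a * b) p i ⟨
    coeff (scale (a * b) p) i       ∎

  scale-shift : ∀ a p → scale a (shift p) ≐ shift (scale a p)
  scale-shift a p = ∷-cong (zeroʳ a) ≐-refl

  scale-zero : ∀ p → scale 0# p ≐ []
  scale-zero p = coeffwise λ i → trans (coeff-scale 0# p i) (zeroˡ _)

  scale-one : ∀ p → scale 1# p ≐ p
  scale-one p = coeffwise λ i → trans (coeff-scale 1# p i) (*-identityˡ _)

  shift-zero : shift [] ≐ []
  shift-zero = coeffwise λ { zero → refl ; (suc i) → refl }

  *ₚ-zeroʳ : ∀ p → p *ₚ [] ≐ []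
  *ₚ-zeroʳ []      = ≐-refl
  *ₚ-zeroʳ (a ∷ p) = ≐-trans (shift-cong (*ₚ-zeroʳ p)) shift-zero

  *ₚ-vanishesˡ : ∀ {p} q → p ≐ [] → p *ₚ q ≐ []
  *ₚ-vanishesˡ {[]}    q p≐0 = ≐-refl
  *ₚ-vanishesˡ {a ∷ p} q p≐0 =
    ≐-trans (+ₚ-cong (≐-trans (scale-cong (coeff-≈ p≐0 0) ≐-refl) (scale-zero q))
                     (≐-trans (shift-cong (*ₚ-vanishesˡ {p} q (coeffwise λ i → coeff-≈ p≐0 (suc i)))) shift-zero))
            ≐-refl

  *ₚ-congˡ : ∀ {p p′} q → p ≐ p′ → p *ₚ q ≐ p′ *ₚ q
  *ₚ-congˡ {[]}    {p′}     q e = ≐-sym (*ₚ-vanishesˡ q (≐-sym e))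
  *ₚ-congˡ {a ∷ p} {[]}     q e = *ₚ-vanishesˡ q e
  *ₚ-congˡ {a ∷ p} {b ∷ p′} q e =
    +ₚ-cong (scale-cong (coeff-≈ e 0) ≐-refl) (shift-cong (*ₚ-congˡ q (∷-injectiveʳ e)))

  *ₚ-congʳ : ∀ p {q q′} → q ≐ q′ → p *ₚ q ≐ p *ₚ q′
  *ₚ-congʳ []      e = ≐-refl
  *ₚ-congʳ (a ∷ p) e = +ₚ-cong (scale-cong refl e) (shift-cong (*ₚ-congʳ p e))

  *ₚ-cong : ∀ {p p′ q q′} → p ≐ p′ → q ≐ q′ → p *ₚ q ≐ p′ *ₚ q′
  *ₚ-cong {p′ = p′} {q} e f = ≐-trans (*ₚ-congˡ q e) (*ₚ-congʳ p′ f)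

  +ₚ-leftComm : ∀ p q r → p +ₚ (q +ₚ r) ≐ q +ₚ (p +ₚ r)
  +ₚ-leftComm p q r = coeffwise λ i → begin
    coeff (p +ₚ (q +ₚ r)) i               ≈⟨ trans (coeff-+ₚ p (q +ₚ r) i) (+-congˡ (coeff-+ₚ q r i)) ⟩
    coeff p i + (coeff q i + coeff r i)   ≈⟨ x∙yz≈y∙xz _ _ _ ⟩
    coeff q i + (coeff p i + coeff r i)   ≈⟨ trans (coeff-+ₚ q (p +ₚ r) i) (+-congˡ (coeff-+ₚ p r i)) ⟨
    coeff (q +ₚ (p +ₚ r)) i               ∎

  *ₚ-distribʳ : ∀ q p p′ → (p +ₚ p′) *ₚ q ≐ p *ₚ q +ₚ p′ *ₚ q
  *ₚ-distribʳ q []      p′       = ≐-refl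
  *ₚ-distribʳ q (a ∷ p) []       = ≐-sym (+ₚ-identityʳ _)
  *ₚ-distribʳ q (a ∷ p) (b ∷ p′) = ≐-trans
    (+ₚ-cong (scale-distribʳ a b q) (≐-trans (shift-cong (*ₚ-distribʳ q p p′)) (shift-+ₚ (p *ₚ q) (p′ *ₚ q))))
    (+ₚ-interchange (scale a q) (scale b q) (shift (p *ₚ q)) (shift (p′ *ₚ q)))

  scale-*ₚ : ∀ a p q → scale a p *ₚ q ≐ scale a (p *ₚ q)
  scale-*ₚ a []      q = ≐-refl
  scale-*ₚ a (b ∷ p) q = ≐-trans
    (+ₚ-cong (≐-sym (scale-scale a b q)) (≐-trans (shift-cong (scale-*ₚ a p q)) (≐-sym (scale-shift a (p *ₚ q)))))
    (≐-sym (scale-+ₚ a (scale b q) (shift (p *ₚ q))))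

  shift-*ₚ : ∀ p q → shift p *ₚ q ≐ shift (p *ₚ q)
  shift-*ₚ p q = +ₚ-cong (scale-zero q) ≐-refl

  *ₚ-assoc : ∀ p q r → (p *ₚ q) *ₚ r ≐ p *ₚ (q *ₚ r)
  *ₚ-assoc []      q r = ≐-refl
  *ₚ-assoc (a ∷ p) q r = ≐-trans (*ₚ-distribʳ r (scale a q) (shift (p *ₚ q)))
    (+ₚ-cong (scale-*ₚ a q r) (≐-trans (shift-*ₚ (p *ₚ q) r) (shift-cong (*ₚ-assoc p q r))))

  *ₚ-∷ʳ : ∀ p b q → p *ₚ (b ∷ q) ≐ scale b p +ₚ shift (p *ₚ q)
  *ₚ-∷ʳ []      b q = ≐-sym shift-zero
  *ₚ-∷ʳ (a ∷ p) b q = ∷-cong (+-congʳ (*-comm a b))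
    (≐-trans (+ₚ-cong ≐-refl (*ₚ-∷ʳ p b q)) (+ₚ-leftComm (scale a q) (scale b p) (shift (p *ₚ q))))

  *ₚ-comm : ∀ p q → p *ₚ q ≐ q *ₚ p
  *ₚ-comm []      q = ≐-sym (*ₚ-zeroʳ q)
  *ₚ-comm (a ∷ p) q = ≐-trans (+ₚ-cong ≐-refl (shift-cong (*ₚ-comm p q))) (≐-sym (*ₚ-∷ʳ q a p))

  constant-*ₚ : ∀ a p → (a ∷ []) *ₚ p ≐ scale a p
  constant-*ₚ a p = ≐-trans (+ₚ-cong ≐-refl shift-zero) (+ₚ-identityʳ (scale a p))

  *ₚ-identityˡ : ∀ p → 1ₚ *ₚ p ≐ p
  *ₚ-identityˡ p = ≐-trans (constant-*ₚ 1# p) (scale-one p)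

  *ₚ-identityʳ : ∀ p → p *ₚ 1ₚ ≐ p
  *ₚ-identityʳ p = ≐-trans (*ₚ-comm p 1ₚ) (*ₚ-identityˡ p)

  Pol-commutativeRing : CommutativeRing c ℓ
  Pol-commutativeRing = record
    { Carrier = Pol
    ; _≈_ = _≐_
    ; _+_ = _+ₚ_
    ; _*_ = _*ₚ_
    ; -_ = -ₚ_
    ; 0# = []
    ; 1# = 1ₚ
    ; isCommutativeRing = record
      { isRing = record
        { +-isAbelianGroup = record
          { isGroup = record
            { isMonoid = record
              { isSemigroup = record
                { isMagma = record { isEquivalence = ≐-isEquivalence ; ∙-cong = +ₚ-cong }
                ; assoc = +ₚ-assoc
                }
              ; identity = (λ _ → ≐-refl) , +ₚ-identityʳ
              }
            ; inverse = (λ p → ≐-trans (+ₚ-comm (-ₚ p) p) (-ₚ-inverseʳ p)) , -ₚ-inverseʳ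
            ; ⁻¹-cong = -ₚ-cong
            }
          ; comm = +ₚ-comm
          }
        ; *-cong = *ₚ-cong
        ; *-assoc = *ₚ-assoc
        ; *-identity = *ₚ-identityˡ , *ₚ-identityʳ
        ; distrib = (λ p q r → ≐-trans (*ₚ-comm p (q +ₚ r)) (≐-trans (*ₚ-distribʳ p q r)
                                 (+ₚ-cong (*ₚ-comm q p) (*ₚ-comm r p))))
                  , *ₚ-distribʳ
        }
      ; *-comm = *ₚ-comm
      }
    }

module Degree {c ℓ} (K : Field c ℓ) where
  open Field K
  open Poly K
  open PolynomialRing K
  open RingProperties ring using (-0#≈0#)
  module ≈-Reasoning = SetoidReasoning setoid
  module ≐-Reasoning = SetoidReasoning ≐-setoid
  open AbelianGroupProperties (CommutativeRing.+-abelianGroup Pol-commutativeRing) using (xyx⁻¹≈y)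

  -- deg p < n; the zero polynomial satisfies it for every n.  A record, like _≐_.
  record DegreeBelow (p : Pol) (n : ℕ) : Set ℓ where
    constructor degreeBelow
    field vanishes : ∀ k → n ≤ k → coeff p k ≈ 0#
  open DegreeBelow public

  monicOfDeg⇒degreeBelow : ∀ {p n} → MonicOfDeg p n → DegreeBelow p (suc n)
  monicOfDeg⇒degreeBelow (_ , deg) = degreeBelow deg

  degreeBelow-cong : ∀ {p q n} → p ≐ q → DegreeBelow p n → DegreeBelow q n
  degreeBelow-cong p≐q deg = degreeBelow λ k n≤k → trans (sym (coeff-≈ p≐q k)) (vanishes deg k n≤k)

  degreeBelow-mono : ∀ {p m n} → m ≤ n → DegreeBelow p m → DegreeBelow p n
  degreeBelow-mono m≤n deg = degreeBelow λ k n≤k → vanishes deg k (≤-trans m≤n n≤k)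

  degreeBelow-zero : ∀ {p} → DegreeBelow p 0 → p ≐ []
  degreeBelow-zero deg = coeffwise λ i → vanishes deg i z≤n

  degreeBelow-tail : ∀ {a p n} → DegreeBelow (a ∷ p) (suc n) → DegreeBelow p n
  degreeBelow-tail deg = degreeBelow λ k n≤k → vanishes deg (suc k) (s≤s n≤k)

  degreeBelow-+ₚ : ∀ {p q n} → DegreeBelow p n → DegreeBelow q n → DegreeBelow (p +ₚ q) n
  degreeBelow-+ₚ {p} {q} degp degq = degreeBelow λ k n≤k →
    trans (coeff-+ₚ p q k) (trans (+-cong (vanishes degp k n≤k) (vanishes degq k n≤k)) (+-identityˡ 0#))

  degreeBelow-scale : ∀ {p n} a → DegreeBelow p n → DegreeBelow (scale a p) n
  degreeBelow-scale {p} a deg = degreeBelow λ k n≤k →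
    trans (coeff-scale a p k) (trans (*-congˡ (vanishes deg k n≤k)) (zeroʳ a))

  degreeBelow--ₚ : ∀ {p n} → DegreeBelow p n → DegreeBelow (-ₚ p) n
  degreeBelow--ₚ = degreeBelow-scale (- 1#)

  degreeBelow-*ₚ : ∀ {p q} m n → DegreeBelow p m → DegreeBelow q (suc n) → DegreeBelow (p *ₚ q) (m +ℕ n)
  degreeBelow-*ₚ {[]}        m       n degp degq = degreeBelow λ _ _ → refl
  degreeBelow-*ₚ {a ∷ p} {q} zero    n degp degq =
    degreeBelow λ k _ → coeff-≈ (*ₚ-vanishesˡ q (degreeBelow-zero degp)) k
  degreeBelow-*ₚ {a ∷ p} {q} (suc m) n degp degq = degreeBelow λ
    { zero    ()
    ; (suc k) (s≤s m+n≤k) → trans (coeff-∷*ₚ a p q (suc k))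
        (trans (+-cong (trans (*-congˡ (vanishes degq (suc k) (s≤s (≤-trans (m≤n+m n m) m+n≤k)))) (zeroʳ a))
                       (vanishes (degreeBelow-*ₚ m n (degreeBelow-tail degp) degq) k m+n≤k))
               (+-identityˡ 0#)) }

  degreeBelow-≐[] : ∀ {p n} → DegreeBelow p n → (∀ k → k < n → coeff p k ≈ 0#) → p ≐ []
  degreeBelow-≐[] {p} {n} deg low = coeffwise λ k → case (k <? n)
    where
    case : ∀ {k} → Dec (k < n) → coeff p k ≈ 0#
    case (yes k<n) = low _ k<n
    case (no k≮n)  = vanishes deg _ (≮⇒≥ k≮n)

  monicOfDeg-zero : ∀ {p} → MonicOfDeg p 0 → p ≐ 1ₚ
  monicOfDeg-zero (lead , deg) = coeffwise λ { zero → lead ; (suc k) → deg (suc k) (s≤s z≤n) }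

  monicOfDeg-cong : ∀ {p q n} → p ≐ q → MonicOfDeg p n → MonicOfDeg q n
  monicOfDeg-cong {n = n} p≐q (lead , deg) =
    trans (sym (coeff-≈ p≐q n)) lead , vanishes (degreeBelow-cong p≐q (degreeBelow deg))

  monicOfDeg-+ₚ : ∀ {p q n} → MonicOfDeg p n → DegreeBelow q n → MonicOfDeg (p +ₚ q) n
  monicOfDeg-+ₚ {p} {q} {n} (lead , deg) degq =
    trans (coeff-+ₚ p q n) (trans (+-cong lead (vanishes degq n ≤-refl)) (+-identityʳ 1#)) ,
    vanishes (degreeBelow-+ₚ {p} (degreeBelow deg) (degreeBelow-mono (n≤1+n n) degq))

  degreeBelow-pred : ∀ {p n} → coeff p n ≈ 0# → DegreeBelow p (suc n) → DegreeBelow p n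
  degreeBelow-pred {p} {n} pₙ≈0 deg = degreeBelow λ k n≤k → case (m≤n⇒m<n∨m≡n n≤k)
    where
    case : ∀ {k} → n < k ⊎ n ≡ k → coeff p k ≈ 0#
    case (inj₁ n<k)    = vanishes deg _ n<k
    case (inj₂ ≡.refl) = pₙ≈0

  monicOfDeg-normalise : ∀ {p n} → ¬ (coeff p n ≈ 0#) → DegreeBelow p (suc n) → ∃[ e ] MonicOfDeg (scale e p) n
  monicOfDeg-normalise {p} {n} pₙ≉0 deg with inverse (coeff p n) pₙ≉0
  ... | e , pₙe≈1 = e , trans (coeff-scale e p n) (trans (*-comm e _) pₙe≈1)
                      , vanishes (degreeBelow-scale e deg)

  ¬¬-monicOfDeg-scale : ∀ {p m} → DegreeBelow p m → ¬ (p ≐ []) →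
                        ¬ ¬ (∃[ j ] j < m × ∃[ e ] MonicOfDeg (scale e p) j)
  ¬¬-monicOfDeg-scale {p} {zero}  deg p≉0 = contradiction (degreeBelow-zero deg) p≉0
  ¬¬-monicOfDeg-scale {p} {suc m} deg p≉0 ¬monic = ¬¬-excluded-middle λ
    { (yes pₘ≈0) → ¬¬-monicOfDeg-scale (degreeBelow-pred pₘ≈0 deg) p≉0
                     λ (j , j<m , monic) → ¬monic (j , m<n⇒m<1+n j<m , monic)
    ; (no pₘ≉0)  → ¬monic (m , ≤-refl , monicOfDeg-normalise pₘ≉0 deg) }

  module _ {B : Pol} {b : ℕ} (monicB : MonicOfDeg B b) where

    private
      coeff-∷*ₚ-above : ∀ c q {k} → b ≤ k → coeff ((c ∷ q) *ₚ B) (suc k) ≈ coeff (q *ₚ B) k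
      coeff-∷*ₚ-above c q {k} b≤k = trans (coeff-∷*ₚ c q B (suc k))
        (trans (+-congʳ (trans (*-congˡ (proj₂ monicB (suc k) (s≤s b≤k))) (zeroʳ c))) (+-identityˡ _))

      degreeBelow-∷*ₚ : ∀ c q {m} → b ≤ m → DegreeBelow ((c ∷ q) *ₚ B) (suc m) → DegreeBelow (q *ₚ B) m
      degreeBelow-∷*ₚ c q b≤m deg = degreeBelow λ k m≤k →
        trans (sym (coeff-∷*ₚ-above c q (≤-trans b≤m m≤k))) (vanishes deg (suc k) (s≤s m≤k))

    coeff-*ₚ-monic : ∀ q n → DegreeBelow q (suc n) → coeff (q *ₚ B) (n +ℕ b) ≈ coeff q n
    coeff-*ₚ-monic []      n       deg = refl
    coeff-*ₚ-monic (c ∷ q) (suc n) deg =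
      trans (coeff-∷*ₚ-above c q (m≤n+m b n)) (coeff-*ₚ-monic q n (degreeBelow-tail deg))
    coeff-*ₚ-monic (c ∷ q) zero    deg = begin
      coeff ((c ∷ q) *ₚ B) b                     ≈⟨ coeff-∷*ₚ c q B b ⟩
      c * coeff B b + coeff (shift (q *ₚ B)) b
        ≈⟨ +-cong (trans (*-congˡ (proj₁ monicB)) (*-identityʳ c))
                  (coeff-≈ (≐-trans (shift-cong (*ₚ-vanishesˡ B (degreeBelow-zero (degreeBelow-tail deg)))) shift-zero) b) ⟩
      c + 0#                                     ≈⟨ +-identityʳ c ⟩
      c                                          ∎
      where open ≈-Reasoning

    degreeBelow-*ₚ-monic : ∀ q n → DegreeBelow (q *ₚ B) (n +ℕ b) → DegreeBelow q n
    degreeBelow-*ₚ-monic []      n       deg = degreeBelow λ _ _ → refl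
    degreeBelow-*ₚ-monic (c ∷ q) (suc n) deg = degreeBelow λ
      { zero    ()
      ; (suc k) (s≤s n≤k) → vanishes (degreeBelow-*ₚ-monic q n (degreeBelow-∷*ₚ c q (m≤n+m b n) deg)) k n≤k }
    degreeBelow-*ₚ-monic (c ∷ q) zero    deg = degreeBelow λ
      { zero    _ → c≈0
      ; (suc k) _ → vanishes q-vanishes k z≤n }
      where
      q-vanishes : DegreeBelow q 0
      q-vanishes = degreeBelow-*ₚ-monic q 0 (degreeBelow-∷*ₚ c q ≤-refl (degreeBelow-mono (n≤1+n b) deg))
      c≈0 : c ≈ 0#
      c≈0 = trans (sym (coeff-*ₚ-monic (c ∷ q) 0 (degreeBelow λ { zero () ; (suc k) _ → vanishes q-vanishes k z≤n })))
                  (vanishes deg b ≤-refl)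

    monicOfDeg-cancelʳ : ∀ {q n} → MonicOfDeg (q *ₚ B) (n +ℕ b) → MonicOfDeg q n
    monicOfDeg-cancelʳ {q} {n} monicqB =
      trans (sym (coeff-*ₚ-monic q n deg)) (proj₁ monicqB) , vanishes deg
      where
      deg : DegreeBelow q (suc n)
      deg = degreeBelow-*ₚ-monic q (suc n) (monicOfDeg⇒degreeBelow monicqB)

    degreeBelow-reduce : ∀ {p} → DegreeBelow p (suc b) → DegreeBelow (p +ₚ -ₚ scale (coeff p b) B) b
    degreeBelow-reduce {p} deg = degreeBelow λ k b≤k → begin
      coeff (p +ₚ -ₚ scale e B) k                ≈⟨ coeff-+ₚ p _ k ⟩
      coeff p k + coeff (-ₚ scale e B) k         ≈⟨ +-congˡ (trans (coeff--ₚ (scale e B) k) (-‿cong (coeff-scale e B k))) ⟩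
      coeff p k - e * coeff B k                  ≈⟨ cases k b≤k ⟩
      0#                                         ∎
      where
      open ≈-Reasoning
      e = coeff p b
      cases : ∀ k → b ≤ k → coeff p k - e * coeff B k ≈ 0#
      cases k b≤k with m≤n⇒m<n∨m≡n b≤k
      ... | inj₂ ≡.refl = trans (+-congˡ (-‿cong (trans (*-congˡ (proj₁ monicB)) (*-identityʳ e)))) (-‿inverseʳ e)
      ... | inj₁ b<k    = trans (+-cong (vanishes deg k b<k) (-‿cong (trans (*-congˡ (proj₂ monicB k b<k)) (zeroʳ e))))
                                (trans (+-identityˡ _) -0#≈0#)

    record Division (X : Pol) : Set (c ⊔ ℓ) where
      field
        quotient remainder : Pol
        remainder-degree   : DegreeBelow remainder b
        division-eq        : X ≐ quotient *ₚ B +ₚ remainder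

    -- Long division working upwards from the constant term.
    divide : ∀ X → Division X
    divide []      = record
      { quotient = [] ; remainder = [] ; remainder-degree = degreeBelow λ _ _ → refl ; division-eq = ≐-refl }
    divide (a ∷ X) = record
      { quotient         = shift q +ₚ (e ∷ [])
      ; remainder        = r′
      ; remainder-degree = degreeBelow-reduce (degreeBelow λ { zero () ; (suc k) (s≤s b≤k) → vanishes r-degree k b≤k })
      ; division-eq      = begin
          a ∷ X                                   ≈⟨ ∷-cong (sym (+-identityˡ a)) eq ⟩
          shift (q *ₚ B) +ₚ (a ∷ r)               ≈⟨ +ₚ-cong (≐-sym (shift-*ₚ q B)) a∷r≐eB+r′ ⟩
          shift q *ₚ B +ₚ ((e ∷ []) *ₚ B +ₚ r′)   ≈⟨ ≐-sym (+ₚ-assoc (shift q *ₚ B) ((e ∷ []) *ₚ B) r′) ⟩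
          shift q *ₚ B +ₚ (e ∷ []) *ₚ B +ₚ r′     ≈⟨ +ₚ-cong (≐-sym (*ₚ-distribʳ B (shift q) (e ∷ []))) ≐-refl ⟩
          (shift q +ₚ (e ∷ [])) *ₚ B +ₚ r′        ∎
      }
      where
      open ≐-Reasoning
      open Division (divide X) renaming (quotient to q; remainder to r; remainder-degree to r-degree; division-eq to eq)
      e  = coeff (a ∷ r) b
      r′ = (a ∷ r) +ₚ -ₚ scale e B
      a∷r≐eB+r′ : a ∷ r ≐ (e ∷ []) *ₚ B +ₚ r′
      a∷r≐eB+r′ = ≐-sym (≐-trans (+ₚ-cong {q = r′} (constant-*ₚ e B) ≐-refl)
                        (≐-trans (≐-sym (+ₚ-assoc (scale e B) (a ∷ r) (-ₚ scale e B))) (xyx⁻¹≈y (scale e B) (a ∷ r))))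

module Determinant {c ℓ} (CR : CommutativeRing c ℓ) where
  open CommutativeRing CR
  open RingProperties ring using (-1*x≈-x; -‿distribˡ-*; -‿distribʳ-*; -0#≈0#; -‿+-comm; -‿involutive; +-inverseˡ-unique)
  open NaturalCoefficientsSolver commutativeSemiring using (solve; _:+_; _:*_; _:=_)
  open SetoidReasoning setoid

  Row : Set c
  Row = ℕ → Carrier

  head : Row → Carrier
  head r = r 0

  tail : Row → Row
  tail r i = r (suc i)

  infix 4 _≈ᵣ_ _≋_
  infixl 6 _+ᵣ_
  infixl 7 _*ᵣ_

  _≈ᵣ_ : Row → Row → Set ℓ
  r ≈ᵣ s = ∀ i → r i ≈ s i

  _≋_ : List Row → List Row → Set (c ⊔ ℓ)
  _≋_ = Pointwise _≈ᵣ_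

  _+ᵣ_ : Row → Row → Row
  (r +ᵣ s) i = r i + s i

  _*ᵣ_ : Carrier → Row → Row
  (k *ᵣ r) i = k * r i

  -- Only the first n entries of each row matter for det n; a list of n rows is an n × n matrix.
  -- det is expanded along the first column, the rows of P having been passed already:
  -- expand n P S = Σᵢ (-1)ⁱ · head Sᵢ · det n (map tail (P ++ S without Sᵢ)).
  mutual
    det : ℕ → List Row → Carrier
    det zero    []      = 1#
    det zero    (_ ∷ _) = 0#
    det (suc n) S       = expand n [] S

    expand : ℕ → List Row → List Row → Carrier
    expand n P []      = 0#
    expand n P (r ∷ S) = head r * det n (map tail (P ++ S)) - expand n (P ++ [ r ]) S

  map-tail-≋ : ∀ {P Q} → P ≋ Q → map tail P ≋ map tail Q
  map-tail-≋ P≋Q = Pointwise.map⁺ tail tail (Pointwise.map (λ r≈s i → r≈s (suc i)) P≋Q)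

  mutual
    det-cong : ∀ n {P Q} → P ≋ Q → det n P ≈ det n Q
    det-cong zero    []      = refl
    det-cong zero    (_ ∷ _) = refl
    det-cong (suc n) P≋Q     = expand-cong n [] P≋Q

    expand-cong : ∀ n {P P′ S S′} → P ≋ P′ → S ≋ S′ → expand n P S ≈ expand n P′ S′
    expand-cong n P≋P′ []          = refl
    expand-cong n P≋P′ (r≈s ∷ S≋S′) =
      +-cong (*-cong (r≈s 0) (det-cong n (map-tail-≋ (Pointwise.++⁺ P≋P′ S≋S′))))
             (-‿cong (expand-cong n (Pointwise.++⁺ P≋P′ (r≈s ∷ [])) S≋S′))

  det-≡ : ∀ n {P Q} → P ≡ Q → det n P ≈ det n Q
  det-≡ n P≡Q = reflexive (≡.cong (det n) P≡Q)

  expand-≡ : ∀ n {P P′} S → P ≡ P′ → expand n P S ≈ expand n P′ S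
  expand-≡ n S P≡P′ = reflexive (≡.cong (λ P → expand n P S) P≡P′)

  det-zero-∷ : ∀ P r S → det 0 (P ++ r ∷ S) ≈ 0#
  det-zero-∷ []      r S = refl
  det-zero-∷ (_ ∷ P) r S = refl

  private
    map-tail-middle : ∀ P r S → map tail (P ++ r ∷ S) ≡ map tail P ++ tail r ∷ map tail S
    map-tail-middle P r S = map-++ tail P (r ∷ S)

    map-tail-passed : ∀ P r P′ S → map tail ((P ++ r ∷ P′) ++ S) ≡ map tail P ++ tail r ∷ map tail (P′ ++ S)
    map-tail-passed P r P′ S = ≡.trans (≡.cong (map tail) (++-assoc P (r ∷ P′) S)) (map-tail-middle P r (P′ ++ S))

    map-tail-segment : ∀ Q X r S → map tail (Q ++ X ++ r ∷ S) ≡ map tail (Q ++ X) ++ tail r ∷ map tail S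
    map-tail-segment Q X r S = ≡.trans (≡.cong (map tail) (≡.sym (++-assoc Q X (r ∷ S)))) (map-tail-middle (Q ++ X) r S)

    -‿linear : ∀ a k b → - (a + k * b) ≈ - a + k * - b
    -‿linear a k b = trans (sym (-‿+-comm a (k * b))) (+-congˡ (-‿distribʳ-* k b))

    expansion-step-linear : ∀ x D₁ D₂ k E₁ E₂ →
      x * (D₁ + k * D₂) - (E₁ + k * E₂) ≈ (x * D₁ - E₁) + k * (x * D₂ - E₂)
    expansion-step-linear x D₁ D₂ k E₁ E₂ = trans (+-congˡ (-‿linear E₁ k E₂))
      (solve 6 (λ x D₁ D₂ k E₁ E₂ → x :* (D₁ :+ k :* D₂) :+ (E₁ :+ k :* E₂) := (x :* D₁ :+ E₁) :+ k :* (x :* D₂ :+ E₂))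
             refl x D₁ D₂ k (- E₁) (- E₂))

  LinearInRows : ℕ → Set (c ⊔ ℓ)
  LinearInRows n = ∀ P S r k s → det n (P ++ r +ᵣ k *ᵣ s ∷ S) ≈ det n (P ++ r ∷ S) + k * det n (P ++ s ∷ S)

  expand-linear-passed : ∀ n → LinearInRows n → ∀ P P′ S r k s →
    expand n (P ++ r +ᵣ k *ᵣ s ∷ P′) S ≈ expand n (P ++ r ∷ P′) S + k * expand n (P ++ s ∷ P′) S
  expand-linear-passed n linear P P′ []      r k s = sym (trans (+-congˡ (zeroʳ k)) (+-identityʳ 0#))
  expand-linear-passed n linear P P′ (x ∷ S) r k s = begin
    expand n (P ++ r +ᵣ k *ᵣ s ∷ P′) (x ∷ S)                    ≈⟨ unfold (r +ᵣ k *ᵣ s) ⟩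
    head x * det n (tP ++ tail r +ᵣ k *ᵣ tail s ∷ tS)
      - expand n (P ++ r +ᵣ k *ᵣ s ∷ P″) S
      ≈⟨ +-cong (*-congˡ (linear tP tS (tail r) k (tail s))) (-‿cong (expand-linear-passed n linear P P″ S r k s)) ⟩
    head x * (det n (tP ++ tail r ∷ tS) + k * det n (tP ++ tail s ∷ tS))
      - (expand n (P ++ r ∷ P″) S + k * expand n (P ++ s ∷ P″) S)
      ≈⟨ expansion-step-linear _ _ _ _ _ _ ⟩
    (head x * det n (tP ++ tail r ∷ tS) - expand n (P ++ r ∷ P″) S)
      + k * (head x * det n (tP ++ tail s ∷ tS) - expand n (P ++ s ∷ P″) S)
      ≈⟨ +-cong (unfold r) (*-congˡ (unfold s)) ⟨
    expand n (P ++ r ∷ P′) (x ∷ S) + k * expand n (P ++ s ∷ P′) (x ∷ S) ∎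
    where
    tP = map tail P
    tS = map tail (P′ ++ S)
    P″ = P′ ++ [ x ]
    unfold : ∀ y → expand n (P ++ y ∷ P′) (x ∷ S) ≈ head x * det n (tP ++ tail y ∷ tS) - expand n (P ++ y ∷ P″) S
    unfold y = +-cong (*-congˡ (det-≡ n (map-tail-passed P y P′ S))) (-‿cong (expand-≡ n S (++-assoc P (y ∷ P′) [ x ])))

  expand-linear : ∀ n → LinearInRows n → ∀ Q X S r k s →
    expand n Q (X ++ r +ᵣ k *ᵣ s ∷ S) ≈ expand n Q (X ++ r ∷ S) + k * expand n Q (X ++ s ∷ S)
  expand-linear n linear Q []      S r k s = begin
    (head r + k * head s) * D - expand n (Q ++ [ r +ᵣ k *ᵣ s ]) S
      ≈⟨ +-cong (*-comm _ D) (-‿cong (expand-linear-passed n linear Q [] S r k s)) ⟩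
    D * (head r + k * head s) - (expand n (Q ++ [ r ]) S + k * expand n (Q ++ [ s ]) S)
      ≈⟨ expansion-step-linear _ _ _ _ _ _ ⟩
    (D * head r - expand n (Q ++ [ r ]) S) + k * (D * head s - expand n (Q ++ [ s ]) S)
      ≈⟨ +-cong (+-congʳ (*-comm D _)) (*-congˡ (+-congʳ (*-comm D _))) ⟩
    (head r * D - expand n (Q ++ [ r ]) S) + k * (head s * D - expand n (Q ++ [ s ]) S) ∎
    where D = det n (map tail (Q ++ S))
  expand-linear n linear Q (x ∷ X) S r k s = begin
    head x * det n (map tail (Q ++ X ++ r +ᵣ k *ᵣ s ∷ S)) - expand n Q′ (X ++ r +ᵣ k *ᵣ s ∷ S)
      ≈⟨ +-cong (*-congˡ (trans (det-≡ n (map-tail-segment Q X _ S)) (linear tQX tS (tail r) k (tail s))))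
                (-‿cong (expand-linear n linear Q′ X S r k s)) ⟩
    head x * (det n (tQX ++ tail r ∷ tS) + k * det n (tQX ++ tail s ∷ tS))
      - (expand n Q′ (X ++ r ∷ S) + k * expand n Q′ (X ++ s ∷ S))
      ≈⟨ expansion-step-linear _ _ _ _ _ _ ⟩
    (head x * det n (tQX ++ tail r ∷ tS) - expand n Q′ (X ++ r ∷ S))
      + k * (head x * det n (tQX ++ tail s ∷ tS) - expand n Q′ (X ++ s ∷ S))
      ≈⟨ +-cong (+-congʳ (*-congˡ (det-≡ n (map-tail-segment Q X r S))))
                (*-congˡ (+-congʳ (*-congˡ (det-≡ n (map-tail-segment Q X s S))))) ⟨
    expand n Q (x ∷ X ++ r ∷ S) + k * expand n Q (x ∷ X ++ s ∷ S) ∎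
    where
    Q′ = Q ++ [ x ]
    tQX = map tail (Q ++ X)
    tS = map tail S

  det-linear : ∀ n → LinearInRows n
  det-linear zero    P S r k s =
    trans (det-zero-∷ P _ S) (sym (trans (+-cong (det-zero-∷ P r S) (trans (*-congˡ (det-zero-∷ P s S)) (zeroʳ k))) (+-identityʳ 0#)))
  det-linear (suc n) P S r k s = expand-linear n (det-linear n) [] P S r k s

  private
    difference-≈0 : ∀ {a b} → a ≈ 0# → b ≈ 0# → a - b ≈ 0#
    difference-≈0 a≈0 b≈0 = trans (+-cong a≈0 (trans (-‿cong b≈0) -0#≈0#)) (+-identityʳ 0#)

    difference-≈0⇒≈0 : ∀ {a b} → a - b ≈ 0# → b ≈ 0# → a ≈ 0#
    difference-≈0⇒≈0 {a} a-b≈0 b≈0 = trans (sym (trans (+-congˡ (trans (-‿cong b≈0) -0#≈0#)) (+-identityʳ a))) a-b≈0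

    +-≈0⇒≈0 : ∀ {a b} → a + b ≈ 0# → a ≈ 0# → b ≈ 0#
    +-≈0⇒≈0 {a} {b} a+b≈0 a≈0 = trans (sym (trans (+-congʳ a≈0) (+-identityˡ b))) a+b≈0

    *-vanishesˡ : ∀ {a} b → a ≈ 0# → a * b ≈ 0#
    *-vanishesˡ b a≈0 = trans (*-congʳ a≈0) (zeroˡ b)

    *-vanishesʳ : ∀ a {b} → b ≈ 0# → a * b ≈ 0#
    *-vanishesʳ a b≈0 = trans (*-congˡ b≈0) (zeroʳ a)

  AlternatingInRows : ℕ → Set (c ⊔ ℓ)
  AlternatingInRows n = ∀ P r S → det n (P ++ r ∷ r ∷ S) ≈ 0#

  expand-alternating-passed : ∀ n → AlternatingInRows n → ∀ P r P′ S → expand n (P ++ r ∷ r ∷ P′) S ≈ 0#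
  expand-alternating-passed n alternating P r P′ []      = refl
  expand-alternating-passed n alternating P r P′ (x ∷ S) = difference-≈0
    (*-vanishesʳ (head x) (trans (det-≡ n (map-tail-passed P r (r ∷ P′) S)) (alternating (map tail P) (tail r) (map tail (P′ ++ S)))))
    (trans (expand-≡ n S (++-assoc P (r ∷ r ∷ P′) [ x ])) (expand-alternating-passed n alternating P r (P′ ++ [ x ]) S))

  expand-alternating : ∀ n → AlternatingInRows n → ∀ Q X r S → expand n Q (X ++ r ∷ r ∷ S) ≈ 0#
  expand-alternating n alternating Q []      r S = begin
    head r * D - (head r * det n (map tail ((Q ++ [ r ]) ++ S)) - expand n ((Q ++ [ r ]) ++ [ r ]) S)
      ≈⟨ +-congˡ (-‿cong (+-cong (*-congˡ (det-≡ n (≡.cong (map tail) (++-assoc Q [ r ] S))))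
                                 (-‿cong (trans (expand-≡ n S (++-assoc Q [ r ] [ r ])) (expand-alternating-passed n alternating Q r [] S))))) ⟩
    head r * D - (head r * D - 0#)   ≈⟨ +-congˡ (-‿cong (trans (+-congˡ -0#≈0#) (+-identityʳ _))) ⟩
    head r * D - head r * D          ≈⟨ -‿inverseʳ _ ⟩
    0#                               ∎
    where D = det n (map tail (Q ++ r ∷ S))
  expand-alternating n alternating Q (x ∷ X) r S = difference-≈0
    (*-vanishesʳ (head x) (trans (det-≡ n (map-tail-segment Q X r (r ∷ S))) (alternating (map tail (Q ++ X)) (tail r) (map tail S))))
    (expand-alternating n alternating (Q ++ [ x ]) X r S)

  det-alternating : ∀ n → AlternatingInRows n
  det-alternating zero    P r S = det-zero-∷ P r (r ∷ S)
  det-alternating (suc n) P r S = expand-alternating n (det-alternating n) [] P r S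

  -- Expand det (P ++ L ∷ L ∷ S) with L = r + s in both rows and drop the two alternating terms.
  det-swap : ∀ n P r s S → det n (P ++ r ∷ s ∷ S) ≈ - det n (P ++ s ∷ r ∷ S)
  det-swap n P r s S = begin
    X                ≈⟨ +-inverseˡ-unique X Y sum≈0 ⟩
    - Y              ∎
    where
    X = det n (P ++ r ∷ s ∷ S)
    Y = det n (P ++ s ∷ r ∷ S)
    L = r +ᵣ 1# *ᵣ s
    expand-second : ∀ y → det n (P ++ y ∷ L ∷ S) ≈ det n (P ++ y ∷ r ∷ S) + det n (P ++ y ∷ s ∷ S)
    expand-second y = begin
      det n (P ++ y ∷ L ∷ S)                                        ≈⟨ det-≡ n (≡.sym (++-assoc P [ y ] (L ∷ S))) ⟩
      det n ((P ++ [ y ]) ++ L ∷ S)                                  ≈⟨ det-linear n (P ++ [ y ]) S r 1# s ⟩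
      det n ((P ++ [ y ]) ++ r ∷ S) + 1# * det n ((P ++ [ y ]) ++ s ∷ S)
        ≈⟨ +-cong (det-≡ n (++-assoc P [ y ] (r ∷ S))) (trans (*-identityˡ _) (det-≡ n (++-assoc P [ y ] (s ∷ S)))) ⟩
      det n (P ++ y ∷ r ∷ S) + det n (P ++ y ∷ s ∷ S)               ∎
    sum≈0 : X + Y ≈ 0#
    sum≈0 = begin
      X + Y                                             ≈⟨ +-cong (+-identityˡ X) (+-identityʳ Y) ⟨
      (0# + X) + (Y + 0#)                               ≈⟨ +-cong (+-congʳ (det-alternating n P r S)) (+-congˡ (det-alternating n P s S)) ⟨
      (det n (P ++ r ∷ r ∷ S) + X) + (Y + det n (P ++ s ∷ s ∷ S))
        ≈⟨ +-cong (expand-second r) (trans (*-identityˡ _) (expand-second s)) ⟨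
      det n (P ++ r ∷ L ∷ S) + 1# * det n (P ++ s ∷ L ∷ S) ≈⟨ det-linear n P (L ∷ S) r 1# s ⟨
      det n (P ++ L ∷ L ∷ S)                            ≈⟨ det-alternating n P L S ⟩
      0#                                                ∎

  det-equal-rows : ∀ n P r Q S → det n (P ++ r ∷ Q ++ r ∷ S) ≈ 0#
  det-equal-rows n P r []      S = det-alternating n P r S
  det-equal-rows n P r (q ∷ Q) S = begin
    det n (P ++ r ∷ q ∷ Q ++ r ∷ S)             ≈⟨ det-swap n P r q (Q ++ r ∷ S) ⟩
    - det n (P ++ q ∷ r ∷ Q ++ r ∷ S)           ≈⟨ -‿cong (det-≡ n (≡.sym (++-assoc P [ q ] (r ∷ Q ++ r ∷ S)))) ⟩
    - det n ((P ++ [ q ]) ++ r ∷ Q ++ r ∷ S)    ≈⟨ -‿cong (det-equal-rows n (P ++ [ q ]) r Q S) ⟩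
    - 0#                                        ≈⟨ -0#≈0# ⟩
    0#                                          ∎

  det-∈ : ∀ n P r S → r ∈ P ⊎ r ∈ S → det n (P ++ r ∷ S) ≈ 0#
  det-∈ n P r S (inj₁ r∈P) with ∈-∃++ r∈P
  ... | P₁ , P₂ , ≡.refl = trans (det-≡ n (++-assoc P₁ (r ∷ P₂) (r ∷ S))) (det-equal-rows n P₁ r P₂ S)
  det-∈ n P r S (inj₂ r∈S) with ∈-∃++ r∈S
  ... | S₁ , S₂ , ≡.refl = det-equal-rows n P r S₁ S₂

  det-addMultiple : ∀ n P x k p S → p ∈ P ⊎ p ∈ S → det n (P ++ x +ᵣ k *ᵣ p ∷ S) ≈ det n (P ++ x ∷ S)
  det-addMultiple n P x k p S p∈ = trans (det-linear n P S x k p)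
    (trans (+-congˡ (*-vanishesʳ k (det-∈ n P p S p∈))) (+-identityʳ _))

  module Elimination (n : ℕ) (p : Row) (multiplier : Row → Carrier) where

    eliminate : Row → Row
    eliminate r = r +ᵣ multiplier r *ᵣ p

    det-eliminate-segment : ∀ Q X S → p ∈ Q ⊎ p ∈ S → det n (Q ++ map eliminate X ++ S) ≈ det n (Q ++ X ++ S)
    det-eliminate-segment Q []      S p∈ = refl
    det-eliminate-segment Q (x ∷ X) S p∈ = begin
      det n (Q ++ eliminate x ∷ map eliminate X ++ S)     ≈⟨ det-≡ n (≡.sym (++-assoc Q [ eliminate x ] _)) ⟩
      det n ((Q ++ [ eliminate x ]) ++ map eliminate X ++ S)
        ≈⟨ det-eliminate-segment (Q ++ [ eliminate x ]) X S (Sum.map₁ ∈-++⁺ˡ p∈) ⟩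
      det n ((Q ++ [ eliminate x ]) ++ X ++ S)            ≈⟨ det-≡ n (++-assoc Q [ eliminate x ] _) ⟩
      det n (Q ++ eliminate x ∷ X ++ S)                   ≈⟨ det-addMultiple n Q x (multiplier x) p (X ++ S) (Sum.map₂ (∈-++⁺ʳ X) p∈) ⟩
      det n (Q ++ x ∷ X ++ S)                             ∎

    det-eliminate : ∀ X Y → det n (map eliminate X ++ p ∷ map eliminate Y) ≈ det n (X ++ p ∷ Y)
    det-eliminate X Y = begin
      det n (map eliminate X ++ p ∷ map eliminate Y)  ≈⟨ det-eliminate-segment [] X (p ∷ map eliminate Y) (inj₂ (here ≡.refl)) ⟩
      det n (X ++ p ∷ map eliminate Y)                ≈⟨ det-≡ n (split (map eliminate Y)) ⟩
      det n ((X ++ [ p ]) ++ map eliminate Y ++ [])   ≈⟨ det-eliminate-segment (X ++ [ p ]) Y [] (inj₁ (∈-++⁺ʳ X (here ≡.refl))) ⟩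
      det n ((X ++ [ p ]) ++ Y ++ [])                 ≈⟨ det-≡ n (split Y) ⟨
      det n (X ++ p ∷ Y)                              ∎
      where
      split : ∀ T → X ++ p ∷ T ≡ (X ++ [ p ]) ++ T ++ []
      split T = ≡.trans (≡.sym (++-assoc X [ p ] T)) (≡.cong ((X ++ [ p ]) ++_) (≡.sym (++-identityʳ T)))

  HeadZero : Row → Set ℓ
  HeadZero r = head r ≈ 0#

  expand-headZero : ∀ m P Y → All HeadZero Y → expand m P Y ≈ 0#
  expand-headZero m P []      []               = refl
  expand-headZero m P (y ∷ Y) (y₀≈0 ∷ Y₀≈0) =
    difference-≈0 (*-vanishesˡ _ y₀≈0) (expand-headZero m (P ++ [ y ]) Y Y₀≈0)

  expand-pass-headZero : ∀ m P X W → All HeadZero X → expand m P (X ++ W) ≈ 0# → expand m (P ++ X) W ≈ 0#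
  expand-pass-headZero m P []      W []              e = trans (expand-≡ m W (++-identityʳ P)) e
  expand-pass-headZero m P (x ∷ X) W (x₀≈0 ∷ X₀≈0) e =
    trans (expand-≡ m W (≡.sym (++-assoc P [ x ] X))) (expand-pass-headZero m (P ++ [ x ]) X W X₀≈0 rest≈0)
    where
    rest≈0 : expand m (P ++ [ x ]) (X ++ W) ≈ 0#
    rest≈0 = begin
      expand m (P ++ [ x ]) (X ++ W)       ≈⟨ -‿involutive _ ⟨
      - - expand m (P ++ [ x ]) (X ++ W)   ≈⟨ -‿cong (+-≈0⇒≈0 e (*-vanishesˡ _ x₀≈0)) ⟩
      - 0#                                 ≈⟨ -0#≈0# ⟩
      0#                                   ∎

  det-pivot : ∀ m X p Y → All HeadZero X → All HeadZero Y →
              det (suc m) (X ++ p ∷ Y) ≈ 0# → head p * det m (map tail (X ++ Y)) ≈ 0#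
  det-pivot m X p Y X₀≈0 Y₀≈0 det≈0 =
    difference-≈0⇒≈0 (expand-pass-headZero m [] X (p ∷ Y) X₀≈0 det≈0) (expand-headZero m (X ++ [ p ]) Y Y₀≈0)

  alternatingSum : ℕ → (ℕ → Carrier) → Carrier
  alternatingSum zero    f = f 0
  alternatingSum (suc n) f = f 0 - alternatingSum n (λ j → f (suc j))

  alternatingSum-cong : ∀ n {f g} → (∀ j → f j ≈ g j) → alternatingSum n f ≈ alternatingSum n g
  alternatingSum-cong zero    f≈g = f≈g 0
  alternatingSum-cong (suc n) f≈g = +-cong (f≈g 0) (-‿cong (alternatingSum-cong n (λ j → f≈g (suc j))))

  alternatingSum-+ : ∀ n f g → alternatingSum n (λ j → f j + g j) ≈ alternatingSum n f + alternatingSum n g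
  alternatingSum-+ zero    f g = refl
  alternatingSum-+ (suc n) f g = begin
    (f 0 + g 0) - alternatingSum n (λ j → f (suc j) + g (suc j))
      ≈⟨ +-congˡ (trans (-‿cong (alternatingSum-+ n _ _)) (sym (-‿+-comm _ _))) ⟩
    (f 0 + g 0) + (- alternatingSum n (λ j → f (suc j)) + - alternatingSum n (λ j → g (suc j)))
      ≈⟨ solve 4 (λ a b c d → (a :+ b) :+ (c :+ d) := (a :+ c) :+ (b :+ d)) refl _ _ _ _ ⟩
    (f 0 - alternatingSum n (λ j → f (suc j))) + (g 0 - alternatingSum n (λ j → g (suc j))) ∎

  alternatingSum-* : ∀ n x f → alternatingSum n (λ j → x * f j) ≈ x * alternatingSum n f
  alternatingSum-* zero    x f = refl
  alternatingSum-* (suc n) x f = begin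
    x * f 0 - alternatingSum n (λ j → x * f (suc j))     ≈⟨ +-congˡ (-‿cong (alternatingSum-* n x _)) ⟩
    x * f 0 - x * alternatingSum n (λ j → f (suc j))     ≈⟨ +-congˡ (-‿distribʳ-* x _) ⟩
    x * f 0 + x * - alternatingSum n (λ j → f (suc j))   ≈⟨ distribˡ x _ _ ⟨
    x * (f 0 - alternatingSum n (λ j → f (suc j)))       ∎

  alternatingSum-- : ∀ n f → alternatingSum n (λ j → - f j) ≈ - alternatingSum n f
  alternatingSum-- n f = begin
    alternatingSum n (λ j → - f j)         ≈⟨ alternatingSum-cong n (λ j → sym (-1*x≈-x (f j))) ⟩
    alternatingSum n (λ j → - 1# * f j)    ≈⟨ alternatingSum-* n (- 1#) f ⟩
    - 1# * alternatingSum n f              ≈⟨ -1*x≈-x _ ⟩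
    - alternatingSum n f                   ∎

  alternatingSum-zero : ∀ n → alternatingSum n (λ _ → 0#) ≈ 0#
  alternatingSum-zero n = begin
    alternatingSum n (λ _ → 0#)        ≈⟨ alternatingSum-cong n (λ _ → sym (zeroˡ 0#)) ⟩
    alternatingSum n (λ _ → 0# * 0#)   ≈⟨ alternatingSum-* n 0# (λ _ → 0#) ⟩
    0# * alternatingSum n (λ _ → 0#)   ≈⟨ zeroˡ _ ⟩
    0#                                 ∎

  deleteColumn : ℕ → Row → Row
  deleteColumn zero    r         = tail r
  deleteColumn (suc j) r zero    = head r
  deleteColumn (suc j) r (suc i) = deleteColumn j (tail r) i

  private
    deleteColumn-tail : ∀ j X → map (deleteColumn j) (map tail X) ≋ map tail (map (deleteColumn (suc j)) X)
    deleteColumn-tail j X =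
      Pointwise.map⁺ (deleteColumn j) tail (Pointwise.map⁺ tail (deleteColumn (suc j)) (Pointwise.refl (λ _ → refl)))

    expand-zero-∷ : ∀ r P S → expand 0 (r ∷ P) S ≈ 0#
    expand-zero-∷ r P []      = refl
    expand-zero-∷ r P (s ∷ S) = difference-≈0 (zeroʳ _) (expand-zero-∷ r (P ++ [ s ]) S)

    expansion-step-exchange : ∀ r s D E → r * (s * D - E) ≈ s * (r * D) + - (r * E)
    expansion-step-exchange r s D E = begin
      r * (s * D - E)             ≈⟨ distribˡ r _ _ ⟩
      r * (s * D) + r * - E       ≈⟨ +-congˡ (-‿distribʳ-* r E) ⟨
      r * (s * D) + - (r * E)     ≈⟨ +-congʳ (solve 3 (λ r s D → r :* (s :* D) := s :* (r :* D)) refl r s D) ⟩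
      s * (r * D) + - (r * E)     ∎

  mutual
    det-expand-first-row : ∀ m r S → det (suc m) (r ∷ S) ≈ alternatingSum m (λ j → r j * det m (map (deleteColumn j) S))
    det-expand-first-row zero    r S = trans (+-congˡ (trans (-‿cong (expand-zero-∷ r [] S)) -0#≈0#)) (+-identityʳ _)
    det-expand-first-row (suc m) r S = +-congˡ (-‿cong (expand-first-row m r [] S))

    expand-first-row : ∀ m r P S → expand (suc m) (r ∷ P) S ≈
      alternatingSum m (λ j → r (suc j) * expand m (map (deleteColumn (suc j)) P) (map (deleteColumn (suc j)) S))
    expand-first-row m r P []      = sym (trans (alternatingSum-cong m (λ _ → zeroʳ _)) (alternatingSum-zero m))
    expand-first-row m r P (s ∷ S) = begin
      head s * det (suc m) (tail r ∷ map tail (P ++ S)) - expand (suc m) (r ∷ P ++ [ s ]) S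
        ≈⟨ +-cong (*-congˡ (det-expand-first-row m (tail r) (map tail (P ++ S)))) (-‿cong (expand-first-row m r (P ++ [ s ]) S)) ⟩
      head s * alternatingSum m (λ j → r (suc j) * det m (map (deleteColumn j) (map tail (P ++ S))))
        - alternatingSum m (λ j → r (suc j) * expand m (map (deleteColumn (suc j)) (P ++ [ s ])) (map (deleteColumn (suc j)) S))
        ≈⟨ +-cong (alternatingSum-* m (head s) _) (alternatingSum-- m _) ⟨
      alternatingSum m (λ j → head s * (r (suc j) * det m (map (deleteColumn j) (map tail (P ++ S)))))
        + alternatingSum m (λ j → - (r (suc j) * expand m (map (deleteColumn (suc j)) (P ++ [ s ])) (map (deleteColumn (suc j)) S)))
        ≈⟨ alternatingSum-+ m _ _ ⟨
      alternatingSum m (λ j → head s * (r (suc j) * det m (map (deleteColumn j) (map tail (P ++ S))))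
        + - (r (suc j) * expand m (map (deleteColumn (suc j)) (P ++ [ s ])) (map (deleteColumn (suc j)) S)))
        ≈⟨ alternatingSum-cong m (λ j → trans (expansion-step-exchange _ _ _ _)
             (+-cong (*-congˡ (*-congˡ (sym (minor j))))
                     (-‿cong (*-congˡ (expand-≡ m (map (deleteColumn (suc j)) S) (≡.sym (map-++ (deleteColumn (suc j)) P [ s ]))))))) ⟨
      alternatingSum m (λ j → r (suc j) * (head s * det m (map tail (map (deleteColumn (suc j)) P ++ map (deleteColumn (suc j)) S))
        - expand m (map (deleteColumn (suc j)) P ++ [ deleteColumn (suc j) s ]) (map (deleteColumn (suc j)) S))) ∎
      where
      minor : ∀ j → det m (map (deleteColumn j) (map tail (P ++ S))) ≈
                    det m (map tail (map (deleteColumn (suc j)) P ++ map (deleteColumn (suc j)) S))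
      minor j = trans (det-cong m (deleteColumn-tail j (P ++ S))) (det-≡ m (≡.cong (map tail) (map-++ (deleteColumn (suc j)) P S)))

  dot : ℕ → Row → Row → Carrier
  dot zero    r v = 0#
  dot (suc n) r v = head r * head v + dot n (tail r) (tail v)

  dot-congʳ : ∀ n r {v w} → v ≈ᵣ w → dot n r v ≈ dot n r w
  dot-congʳ zero    r v≈w = refl
  dot-congʳ (suc n) r v≈w = +-cong (*-congˡ (v≈w 0)) (dot-congʳ n (tail r) (λ i → v≈w (suc i)))

  dot-*ʳ : ∀ n r x v → dot n r (x *ᵣ v) ≈ x * dot n r v
  dot-*ʳ zero    r x v = sym (zeroʳ x)
  dot-*ʳ (suc n) r x v = begin
    head r * (x * head v) + dot n (tail r) (x *ᵣ tail v)   ≈⟨ +-congˡ (dot-*ʳ n (tail r) x (tail v)) ⟩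
    head r * (x * head v) + x * dot n (tail r) (tail v)    ≈⟨ solve 4 (λ a x b d → a :* (x :* b) :+ x :* d := x :* (a :* b :+ d)) refl _ x _ _ ⟩
    x * (head r * head v + dot n (tail r) (tail v))        ∎

  dot-linearˡ : ∀ n r k s v → dot n (r +ᵣ k *ᵣ s) v ≈ dot n r v + k * dot n s v
  dot-linearˡ zero    r k s v = sym (trans (+-congˡ (zeroʳ k)) (+-identityʳ 0#))
  dot-linearˡ (suc n) r k s v = begin
    (head r + k * head s) * head v + dot n (tail r +ᵣ k *ᵣ tail s) (tail v)
      ≈⟨ +-congˡ (dot-linearˡ n (tail r) k (tail s) (tail v)) ⟩
    (head r + k * head s) * head v + (dot n (tail r) (tail v) + k * dot n (tail s) (tail v))
      ≈⟨ solve 6 (λ a k b v d e → (a :+ k :* b) :* v :+ (d :+ k :* e) := (a :* v :+ d) :+ k :* (b :* v :+ e)) refl _ k _ _ _ _ ⟩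
    (head r * head v + dot n (tail r) (tail v)) + k * (head s * head v + dot n (tail s) (tail v)) ∎

  dot-zeroˡ : ∀ n v → dot n (λ _ → 0#) v ≈ 0#
  dot-zeroˡ zero    v = refl
  dot-zeroˡ (suc n) v = trans (+-cong (zeroˡ _) (dot-zeroˡ n (tail v))) (+-identityʳ 0#)

  dot-zeroʳ : ∀ n r → dot n r (λ _ → 0#) ≈ 0#
  dot-zeroʳ zero    r = refl
  dot-zeroʳ (suc n) r = trans (+-cong (zeroʳ _) (dot-zeroʳ n (tail r))) (+-identityʳ 0#)

  sign : ℕ → Carrier
  sign zero    = 1#
  sign (suc j) = - sign j

  alternatingSum-dot : ∀ m r (D : ℕ → Carrier) → alternatingSum m (λ j → r j * D j) ≈ dot (suc m) r (λ j → sign j * D j)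
  alternatingSum-dot zero    r D = sym (trans (+-identityʳ _) (*-congˡ (*-identityˡ _)))
  alternatingSum-dot (suc m) r D = begin
    r 0 * D 0 - alternatingSum m (λ j → r (suc j) * D (suc j))
      ≈⟨ +-congˡ (-‿cong (alternatingSum-dot m (tail r) (tail D))) ⟩
    r 0 * D 0 - dot (suc m) (tail r) (λ j → sign j * D (suc j))
      ≈⟨ +-cong (*-congˡ (*-identityˡ _)) (trans (dot-*ʳ (suc m) (tail r) (- 1#) (λ j → sign j * D (suc j))) (-1*x≈-x _)) ⟨
    r 0 * (1# * D 0) + dot (suc m) (tail r) (- 1# *ᵣ (λ j → sign j * D (suc j)))
      ≈⟨ +-congˡ (dot-congʳ (suc m) (tail r) (λ j → trans (sym (*-assoc (- 1#) (sign j) (D (suc j)))) (*-congʳ (-1*x≈-x (sign j))))) ⟩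
    r 0 * (1# * D 0) + dot (suc m) (tail r) (λ j → - sign j * D (suc j)) ∎

  cofactors : ℕ → List Row → Row
  cofactors m S j = sign j * det m (map (deleteColumn j) S)

  dot-cofactors : ∀ m r S → dot (suc m) r (cofactors m S) ≈ det (suc m) (r ∷ S)
  dot-cofactors m r S = sym (trans (det-expand-first-row m r S) (alternatingSum-dot m r (λ j → det m (map (deleteColumn j) S))))

  dot-cofactors-∈ : ∀ m s S → s ∈ S → dot (suc m) s (cofactors m S) ≈ 0#
  dot-cofactors-∈ m s S s∈S = trans (dot-cofactors m s S) (det-∈ (suc m) [] s S (inj₂ s∈S))

module NonSingular {c ℓ} (K : Field c ℓ) where
  open Field K
  open Determinant commutativeRing
  open RingProperties ring using (-‿distribˡ-*; -‿distribʳ-*)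
  open SetoidReasoning setoid

  TrivialKernel : ℕ → List Row → Set (c ⊔ ℓ)
  TrivialKernel n S = ∀ v → All (λ r → dot n r v ≈ 0#) S → ∀ j → j < n → v j ≈ 0#

  ¬¬-nonzeroHead : ∀ S → ¬ All HeadZero S → ¬ ¬ (∃[ p ] p ∈ S × ¬ HeadZero p)
  ¬¬-nonzeroHead []      ¬all = contradiction [] ¬all
  ¬¬-nonzeroHead (r ∷ S) ¬all ¬pivot = ¬¬-excluded-middle λ
    { (yes r₀≈0) → ¬¬-nonzeroHead S (λ all → ¬all (r₀≈0 ∷ all)) λ (p , p∈S , p₀≉0) → ¬pivot (p , there p∈S , p₀≉0)
    ; (no r₀≉0)  → ¬pivot (r , here ≡.refl , r₀≉0) }

  module Pivot (m : ℕ) (p : Row) (i : Carrier) (p₀i≈1 : head p * i ≈ 1#) where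

    open Elimination (suc m) p (λ r → - (head r * i)) public

    eliminate-headZero : ∀ r → HeadZero (eliminate r)
    eliminate-headZero r = begin
      head r + - (head r * i) * head p   ≈⟨ +-congˡ (*-congʳ (-‿cong (*-comm _ i))) ⟩
      head r + - (i * head r) * head p   ≈⟨ +-congˡ (sym (-‿distribˡ-* _ _)) ⟩
      head r - i * head r * head p       ≈⟨ +-congˡ (-‿cong (trans (*-assoc i _ _) (trans (*-comm i _) (trans (*-assoc _ _ i) (trans (*-congˡ p₀i≈1) (*-identityʳ _)))))) ⟩
      head r - head r                    ≈⟨ -‿inverseʳ _ ⟩
      0#                                 ∎

    lift : Row → Row
    lift w zero    = - (i * dot m (tail p) w)
    lift w (suc j) = w j

    dot-pivot-lift : ∀ w → dot (suc m) p (lift w) ≈ 0#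
    dot-pivot-lift w = begin
      head p * - (i * D) + D    ≈⟨ +-congʳ (sym (-‿distribʳ-* _ _)) ⟩
      - (head p * (i * D)) + D  ≈⟨ +-congʳ (-‿cong (trans (sym (*-assoc _ _ _)) (trans (*-congʳ p₀i≈1) (*-identityˡ D)))) ⟩
      - D + D                   ≈⟨ -‿inverseˡ D ⟩
      0#                        ∎
      where D = dot m (tail p) w

    dot-lift : ∀ w r → dot m (tail (eliminate r)) w ≈ 0# → dot (suc m) r (lift w) ≈ 0#
    dot-lift w r minor≈0 = begin
      dot (suc m) r (lift w)                                  ≈⟨ +-identityʳ _ ⟨
      dot (suc m) r (lift w) + 0#                             ≈⟨ +-congˡ (trans (*-congˡ (dot-pivot-lift w)) (zeroʳ _)) ⟨
      dot (suc m) r (lift w) + - (head r * i) * dot (suc m) p (lift w) ≈⟨ dot-linearˡ (suc m) r _ p (lift w) ⟨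
      dot (suc m) (eliminate r) (lift w)                      ≈⟨ +-cong (trans (*-congʳ (eliminate-headZero r)) (zeroˡ _)) minor≈0 ⟩
      0# + 0#                                                 ≈⟨ +-identityˡ 0# ⟩
      0#                                                      ∎

  -- Either all heads vanish and e₀ is in the kernel, or elimination with a pivot row of invertible
  -- head turns det S ≈ 0 into the vanishing of a minor whose kernel is again trivial (via lift).
  det≉0 : ∀ n S → length S ≡ n → TrivialKernel n S → ¬ (det n S ≈ 0#)
  det≉0 zero    []      _  _       det≈0 = 0#≉1# (sym det≈0)
  det≉0 (suc m) S       len trivial det≈0 = ¬¬-excluded-middle λ
    { (yes S₀≈0) → 0#≉1# (sym (trivial e₀ (All.map (λ {r} → dot-e₀ r) S₀≈0) 0 (s≤s z≤n)))
    ; (no ¬S₀≈0) → ¬¬-nonzeroHead S ¬S₀≈0 λ (p , p∈S , p₀≉0) → pivot-step p p∈S p₀≉0 }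
    where
    e₀ : Row
    e₀ zero    = 1#
    e₀ (suc _) = 0#

    dot-e₀ : ∀ r → HeadZero r → dot (suc m) r e₀ ≈ 0#
    dot-e₀ r r₀≈0 = trans (+-cong (trans (*-identityʳ _) r₀≈0) (dot-zeroʳ m (tail r))) (+-identityˡ 0#)

    pivot-step : ∀ p → p ∈ S → ¬ HeadZero p → ⊥
    pivot-step p p∈S p₀≉0 with ∈-∃++ p∈S | inverse (head p) p₀≉0
    ... | X , Y , ≡.refl | i , p₀i≈1 = det≉0 m M length-M trivial-M det-M≈0
      where
      open Pivot m p i p₀i≈1

      M : List Row
      M = map tail (map eliminate X ++ map eliminate Y)

      length-M : length M ≡ m
      length-M = ≡.trans (length-map tail (map eliminate X ++ map eliminate Y)) (≡.trans (≡.cong length (≡.sym (map-++ eliminate X Y)))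
                 (≡.trans (length-map eliminate (X ++ Y)) (suc-injective (≡.trans (≡.sym (length-++-sucʳ X p Y)) len))))

      heads-zero : ∀ Z → All HeadZero (map eliminate Z)
      heads-zero Z = map⁺ (All.tabulate λ {r} _ → eliminate-headZero r)

      det-M≈0 : det m M ≈ 0#
      det-M≈0 = begin
        det m M                  ≈⟨ *-identityˡ _ ⟨
        1# * det m M             ≈⟨ *-congʳ (trans (*-comm i _) p₀i≈1) ⟨
        i * head p * det m M     ≈⟨ *-assoc _ _ _ ⟩
        i * (head p * det m M)   ≈⟨ *-congˡ (det-pivot m (map eliminate X) p (map eliminate Y) (heads-zero X) (heads-zero Y)
                                                      (trans (det-eliminate X Y) det≈0)) ⟩
        i * 0#                   ≈⟨ zeroʳ i ⟩
        0#                       ∎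

      trivial-M : TrivialKernel m M
      trivial-M w M·w≈0 j j<m = trivial (lift w) (++⁺ (All.map (λ {r} → dot-lift w r) X·w≈0)
                                                      (dot-pivot-lift w ∷ All.map (λ {r} → dot-lift w r) Y·w≈0))
                                        (suc j) (s≤s j<m)
        where
        XY·w≈0 = map⁻ M·w≈0
        X·w≈0 = map⁻ (++⁻ˡ (map eliminate X) XY·w≈0)
        Y·w≈0 = map⁻ (++⁻ʳ (map eliminate X) XY·w≈0)

module CoefficientVectors {c ℓ} (K : Field c ℓ) where
  open Field K
  open Poly K
  open PolynomialRing K
  open Degree K
  open Determinant commutativeRing
  open SetoidReasoning setoid

  coefficients : ℕ → Row → Pol
  coefficients zero    v = []
  coefficients (suc m) v = head v ∷ coefficients m (tail v)

  degreeBelow-coefficients : ∀ m v → DegreeBelow (coefficients m v) m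
  degreeBelow-coefficients zero    v = degreeBelow λ _ _ → refl
  degreeBelow-coefficients (suc m) v = degreeBelow λ
    { zero () ; (suc k) (s≤s m≤k) → vanishes (degreeBelow-coefficients m (tail v)) k m≤k }

  coefficients-≐[] : ∀ m v → coefficients m v ≐ [] → ∀ j → j < m → v j ≈ 0#
  coefficients-≐[] (suc m) v v≐0 zero    _         = coeff-≈ v≐0 0
  coefficients-≐[] (suc m) v v≐0 (suc j) (s≤s j<m) =
    coefficients-≐[] m (tail v) (coeffwise λ i → coeff-≈ v≐0 (suc i)) j j<m

  coefficients-split-≐[] : ∀ a b v → coefficients a v ≐ [] → coefficients b (λ j → v (a +ℕ j)) ≐ [] →
                           ∀ j → j < a +ℕ b → v j ≈ 0#
  coefficients-split-≐[] zero    b v _     rest≐0 = coefficients-≐[] b v rest≐0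
  coefficients-split-≐[] (suc a) b v v≐0 rest≐0 zero    _         = coeff-≈ v≐0 0
  coefficients-split-≐[] (suc a) b v v≐0 rest≐0 (suc j) (s≤s j<n) =
    coefficients-split-≐[] a b (tail v) (coeffwise λ i → coeff-≈ v≐0 (suc i)) rest≐0 j j<n

  shiftBy : ℕ → Pol → Pol
  shiftBy zero    p = p
  shiftBy (suc i) p = shift (shiftBy i p)

  -- λ i → coeff (shiftBy i P) k is row k of the matrix of p ↦ p P acting on coefficient vectors.
  dot-shiftBy : ∀ m P k v → dot m (λ i → coeff (shiftBy i P) k) v ≈ coeff (coefficients m v *ₚ P) k
  dot-shiftBy zero    P k       v = refl
  dot-shiftBy (suc m) P zero    v = begin
    coeff P 0 * head v + dot m (λ i → coeff (shiftBy (suc i) P) 0) (tail v)  ≈⟨ +-cong (*-comm _ _) (dot-zeroˡ m (tail v)) ⟩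
    head v * coeff P 0 + 0#                                                 ≈⟨ coeff-∷*ₚ (head v) (coefficients m (tail v)) P 0 ⟨
    coeff (coefficients (suc m) v *ₚ P) 0                                   ∎
  dot-shiftBy (suc m) P (suc k) v = begin
    coeff P (suc k) * head v + dot m (λ i → coeff (shiftBy i P) k) (tail v)
      ≈⟨ +-cong (*-comm _ _) (dot-shiftBy m P k (tail v)) ⟩
    head v * coeff P (suc k) + coeff (coefficients m (tail v) *ₚ P) k
      ≈⟨ coeff-∷*ₚ (head v) (coefficients m (tail v)) P (suc k) ⟨
    coeff (coefficients (suc m) v *ₚ P) (suc k) ∎

  splice : ℕ → Row → Row → Row
  splice zero    F G j       = G j
  splice (suc a) F G zero    = head F
  splice (suc a) F G (suc j) = splice a (tail F) G j

  dot-splice : ∀ a b F G v → dot (a +ℕ b) (splice a F G) v ≈ dot a F v + dot b G (λ j → v (a +ℕ j))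
  dot-splice zero    b F G v = sym (+-identityˡ _)
  dot-splice (suc a) b F G v = trans (+-congˡ (dot-splice a b (tail F) G (tail v))) (sym (+-assoc _ _ _))

module Bezout {c ℓ} (K : Field c ℓ) {A B : Poly.Pol K} {a b : ℕ}
              (monicA : Poly.MonicOfDeg K A a) (monicB : Poly.MonicOfDeg K B b) where
  open Poly K
  open Field K
  open PolynomialRing K
  open Degree K
  open Determinant commutativeRing
  open NonSingular K
  open CoefficientVectors K
  open CommutativeRing Pol-commutativeRing using () renaming (commutativeSemiring to Pol-commutativeSemiring)
  open RingProperties (CommutativeRing.ring Pol-commutativeRing) using () renaming (x≈z//y to x+y≐z⇒x≐z-y; [y-z]x≈yx-zx to -ₚ-distribʳ-*ₚ)
  open NaturalCoefficientsSolver Pol-commutativeSemiring using (solve; _:+_; _:*_; _:=_)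

  infix 4 _∈⟨A,B⟩
  record _∈⟨A,B⟩ (g : Pol) : Set (c ⊔ ℓ) where
    constructor combination
    field
      coeffA coeffB : Pol
      combination-eq : g ≐ coeffA *ₚ A +ₚ coeffB *ₚ B

  A∈⟨A,B⟩ : A ∈⟨A,B⟩
  A∈⟨A,B⟩ = combination 1ₚ [] (≐-sym (≐-trans (+ₚ-identityʳ (1ₚ *ₚ A)) (*ₚ-identityˡ A)))

  B∈⟨A,B⟩ : B ∈⟨A,B⟩
  B∈⟨A,B⟩ = combination [] 1ₚ (≐-sym (*ₚ-identityˡ B))

  ∈⟨A,B⟩-cong : ∀ {g h} → g ≐ h → g ∈⟨A,B⟩ → h ∈⟨A,B⟩
  ∈⟨A,B⟩-cong g≐h (combination x y eq) = combination x y (≐-trans (≐-sym g≐h) eq)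

  ∈⟨A,B⟩-+ₚ : ∀ {g h} → g ∈⟨A,B⟩ → h ∈⟨A,B⟩ → g +ₚ h ∈⟨A,B⟩
  ∈⟨A,B⟩-+ₚ (combination x y eq) (combination x′ y′ eq′) = combination (x +ₚ x′) (y +ₚ y′) (≐-trans (+ₚ-cong eq eq′)
    (solve 6 (λ x y x′ y′ A B → (x :* A :+ y :* B) :+ (x′ :* A :+ y′ :* B) := (x :+ x′) :* A :+ (y :+ y′) :* B)
           ≐-refl x y x′ y′ A B))

  ∈⟨A,B⟩-*ₚ : ∀ p {g} → g ∈⟨A,B⟩ → p *ₚ g ∈⟨A,B⟩
  ∈⟨A,B⟩-*ₚ p (combination x y eq) = combination (p *ₚ x) (p *ₚ y) (≐-trans (*ₚ-congʳ p eq)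
    (solve 5 (λ p x y A B → p :* (x :* A :+ y :* B) := (p :* x) :* A :+ (p :* y) :* B) ≐-refl p x y A B))

  ∈⟨A,B⟩-scale : ∀ e {g} → g ∈⟨A,B⟩ → scale e g ∈⟨A,B⟩
  ∈⟨A,B⟩-scale e {g} g∈ = ∈⟨A,B⟩-cong (constant-*ₚ e g) (∈⟨A,B⟩-*ₚ (e ∷ []) g∈)

  MonicOfDegIn⟨A,B⟩ : ℕ → Set (c ⊔ ℓ)
  MonicOfDegIn⟨A,B⟩ m = ∃[ g ] (MonicOfDeg g m × g ∈⟨A,B⟩)

  ¬¬-minimalMonic : ∀ n → MonicOfDegIn⟨A,B⟩ n →
                    ¬ ¬ (∃[ m ] (MonicOfDegIn⟨A,B⟩ m × ∀ k → k < m → ¬ MonicOfDegIn⟨A,B⟩ k))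
  ¬¬-minimalMonic = <-rec _ λ n smaller gₙ ¬minimal → ¬¬-excluded-middle {A = ∃[ k ] (k < n × MonicOfDegIn⟨A,B⟩ k)} λ
    { (yes (k , k<n , gₖ)) → smaller k<n gₖ ¬minimal
    ; (no none)            → ¬minimal (n , gₙ , λ k k<n gₖ → none (k , k<n , gₖ)) }

  -- The remainder of h modulo a monic g of minimal degree in ⟨A,B⟩ lies in ⟨A,B⟩ and has smaller
  -- degree, so it cannot be nonzero.
  ¬¬-minimalMonic-∣ₚ : ∀ {g m} → MonicOfDeg g m → g ∈⟨A,B⟩ → (∀ k → k < m → ¬ MonicOfDegIn⟨A,B⟩ k) →
                       ∀ {h} → h ∈⟨A,B⟩ → ¬ ¬ (g ∣ₚ h)
  ¬¬-minimalMonic-∣ₚ {g} monic-g g∈ minimal {h} h∈ ¬g∣h = ¬¬-excluded-middle λ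
    { (yes r≐0) → ¬g∣h (q , coeff-≈ (≐-trans (*ₚ-comm g q) (≐-sym (≐-trans eq (≐-trans (+ₚ-cong ≐-refl r≐0) (+ₚ-identityʳ _))))))
    ; (no r≉0)  → ¬¬-monicOfDeg-scale r-degree r≉0 λ (j , j<m , e , monic) → minimal j j<m (scale e r , monic , ∈⟨A,B⟩-scale e r∈) }
    where
    open Division {B = g} (divide monic-g h) renaming (quotient to q; remainder to r; remainder-degree to r-degree; division-eq to eq)
    r∈ : r ∈⟨A,B⟩
    r∈ = ∈⟨A,B⟩-cong (≐-sym (x+y≐z⇒x≐z-y r (q *ₚ g) h (≐-trans (+ₚ-comm r (q *ₚ g)) (≐-sym eq))))
                     (∈⟨A,B⟩-+ₚ h∈ (∈⟨A,B⟩-scale (- 1#) (∈⟨A,B⟩-*ₚ q g∈)))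

  ¬¬-bezout : Coprime A B → ¬ ¬ (1ₚ ∈⟨A,B⟩)
  ¬¬-bezout coprime ¬bezout =
    ¬¬-minimalMonic a (A , monicA , A∈⟨A,B⟩) λ (m , (g , monic-g , g∈) , minimal) →
    ¬¬-minimalMonic-∣ₚ monic-g g∈ minimal A∈⟨A,B⟩ λ g∣A →
    ¬¬-minimalMonic-∣ₚ monic-g g∈ minimal B∈⟨A,B⟩ λ g∣B →
    let (v , gv≈1) = coprime g g∣A g∣B in
    ¬bezout (∈⟨A,B⟩-cong (≐-trans (*ₚ-comm v g) (coeffwise gv≈1)) (∈⟨A,B⟩-*ₚ v g∈))

  sylvesterRow : ℕ → Row
  sylvesterRow k = splice a (λ i → coeff (shiftBy i B) k) (λ i → coeff (shiftBy i A) k)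

  sylvesterPol : Row → Pol
  sylvesterPol v = coefficients a v *ₚ B +ₚ coefficients b (λ j → v (a +ℕ j)) *ₚ A

  dot-sylvesterRow : ∀ k v → dot (a +ℕ b) (sylvesterRow k) v ≈ coeff (sylvesterPol v) k
  dot-sylvesterRow k v = begin
    dot (a +ℕ b) (sylvesterRow k) v
      ≈⟨ dot-splice a b (λ i → coeff (shiftBy i B) k) (λ i → coeff (shiftBy i A) k) v ⟩
    dot a (λ i → coeff (shiftBy i B) k) v + dot b (λ i → coeff (shiftBy i A) k) (λ j → v (a +ℕ j))
      ≈⟨ +-cong (dot-shiftBy a B k v) (dot-shiftBy b A k (λ j → v (a +ℕ j))) ⟩
    coeff (coefficients a v *ₚ B) k + coeff (coefficients b (λ j → v (a +ℕ j)) *ₚ A) k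
      ≈⟨ coeff-+ₚ (coefficients a v *ₚ B) _ k ⟨
    coeff (sylvesterPol v) k ∎
    where open SetoidReasoning setoid

  degreeBelow-sylvesterPol : ∀ v → DegreeBelow (sylvesterPol v) (a +ℕ b)
  degreeBelow-sylvesterPol v = degreeBelow-+ₚ {coefficients a v *ₚ B}
    (degreeBelow-*ₚ a b (degreeBelow-coefficients a v) (monicOfDeg⇒degreeBelow monicB))
    (degreeBelow-mono (≤-reflexive (+ℕ-comm b a)) (degreeBelow-*ₚ b a (degreeBelow-coefficients b _) (monicOfDeg⇒degreeBelow monicA)))

  -- With u A + w B = 1, a relation y B + x A = 0 gives y = (y u - w x) A; as deg y < a = deg A this forces y = 0.
  combination-≐[] : 1ₚ ∈⟨A,B⟩ → ∀ {x y} → DegreeBelow y a → y *ₚ B +ₚ x *ₚ A ≐ [] → y ≐ [] × x ≐ []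
  combination-≐[] (combination u w 1≐uA+wB) {x} {y} deg-y yB+xA≐0 = y≐0 , x≐0
    where
    open SetoidReasoning ≐-setoid
    Q = y *ₚ u +ₚ -ₚ (w *ₚ x)
    y≐QA : y ≐ Q *ₚ A
    y≐QA = ≐-trans (x+y≐z⇒x≐z-y y ((w *ₚ x) *ₚ A) ((y *ₚ u) *ₚ A) (begin
      y +ₚ (w *ₚ x) *ₚ A                            ≈⟨ +ₚ-cong (≐-trans (≐-sym (*ₚ-identityʳ y)) (*ₚ-congʳ y 1≐uA+wB)) ≐-refl ⟩
      y *ₚ (u *ₚ A +ₚ w *ₚ B) +ₚ (w *ₚ x) *ₚ A
        ≈⟨ solve 6 (λ y u A w B x → y :* (u :* A :+ w :* B) :+ (w :* x) :* A := (y :* u) :* A :+ w :* (y :* B :+ x :* A))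
                 ≐-refl y u A w B x ⟩
      (y *ₚ u) *ₚ A +ₚ w *ₚ (y *ₚ B +ₚ x *ₚ A)     ≈⟨ +ₚ-cong ≐-refl (≐-trans (*ₚ-congʳ w yB+xA≐0) (*ₚ-zeroʳ w)) ⟩
      (y *ₚ u) *ₚ A +ₚ []                           ≈⟨ +ₚ-identityʳ _ ⟩
      (y *ₚ u) *ₚ A                                  ∎))
      (≐-sym (-ₚ-distribʳ-*ₚ A (y *ₚ u) (w *ₚ x)))
    y≐0 : y ≐ []
    y≐0 = ≐-trans y≐QA (*ₚ-vanishesˡ A (degreeBelow-zero (degreeBelow-*ₚ-monic monicA Q 0 (degreeBelow-cong y≐QA deg-y))))
    x≐0 : x ≐ []
    x≐0 = degreeBelow-zero (degreeBelow-*ₚ-monic monicA x 0 (degreeBelow λ k _ → coeff-≈ xA≐0 k))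
      where
      xA≐0 : x *ₚ A ≐ []
      xA≐0 = ≐-trans (+ₚ-cong (≐-sym (*ₚ-vanishesˡ B y≐0)) ≐-refl) yB+xA≐0

  sylvester-trivialKernel : 1ₚ ∈⟨A,B⟩ → TrivialKernel (a +ℕ b) (applyUpTo sylvesterRow (a +ℕ b))
  sylvester-trivialKernel bezout v rows·v≈0 =
    let (y≐0 , x≐0) = combination-≐[] bezout {coefficients b (λ j → v (a +ℕ j))} (degreeBelow-coefficients a v) image≐0
    in coefficients-split-≐[] a b v y≐0 x≐0
    where
    image≐0 : sylvesterPol v ≐ []
    image≐0 = degreeBelow-≐[] (degreeBelow-sylvesterPol v)
      λ k k<n → trans (sym (dot-sylvesterRow k v)) (applyUpTo⁻ sylvesterRow (a +ℕ b) rows·v≈0 k<n)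

  sylvester-det≉0 : Coprime A B → ¬ (det (a +ℕ b) (applyUpTo sylvesterRow (a +ℕ b)) ≈ 0#)
  sylvester-det≉0 coprime det≈0 = ¬¬-bezout coprime λ bezout →
    det≉0 (a +ℕ b) _ (length-applyUpTo sylvesterRow (a +ℕ b)) (sylvester-trivialKernel bezout) det≈0

  -- By Cramer's rule the cofactors of rows 1, …, a + b − 1 solve the Sylvester system with
  -- right-hand side (det, 0, …, 0), which yields a combination equal to the constant det.
  cramer-bezout : ∀ {m} → a +ℕ b ≡ suc m → ¬ (det (a +ℕ b) (applyUpTo sylvesterRow (a +ℕ b)) ≈ 0#) → 1ₚ ∈⟨A,B⟩
  cramer-bezout {m} a+b≡1+m det≉0 =
    let (e , De≈1) = inverse D (≡.subst (λ n → ¬ (det n (applyUpTo sylvesterRow n) ≈ 0#)) a+b≡1+m det≉0)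
    in ∈⟨A,B⟩-cong (∷-cong (trans (*-comm e D) De≈1) ≐-refl) (∈⟨A,B⟩-scale e D∈⟨A,B⟩)
    where
    L = applyUpTo (sylvesterRow ∘ suc) m
    D = det (suc m) (sylvesterRow 0 ∷ L)
    w = cofactors m L
    dot-row : ∀ k → dot (suc m) (sylvesterRow k) w ≈ coeff (sylvesterPol w) k
    dot-row k = ≡.subst (λ n → dot n (sylvesterRow k) w ≈ coeff (sylvesterPol w) k) a+b≡1+m (dot-sylvesterRow k w)
    image≐D : sylvesterPol w ≐ D ∷ []
    image≐D = coeffwise λ
      { zero    → trans (sym (dot-row 0)) (dot-cofactors m (sylvesterRow 0) L)
      ; (suc k) → case (suc k <? suc m) }
      where
      case : ∀ {k} → Dec (suc k < suc m) → coeff (sylvesterPol w) (suc k) ≈ 0#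
      case {k} (yes (s≤s k<m)) = trans (sym (dot-row (suc k))) (dot-cofactors-∈ m _ L (∈-applyUpTo⁺ (sylvesterRow ∘ suc) k<m))
      case {k} (no k≮n)         = vanishes (degreeBelow-sylvesterPol w) _ (≡.subst (_≤ suc k) (≡.sym a+b≡1+m) (≮⇒≥ k≮n))
    D∈⟨A,B⟩ : D ∷ [] ∈⟨A,B⟩
    D∈⟨A,B⟩ = ∈⟨A,B⟩-cong image≐D
      (combination (coefficients b (λ j → w (a +ℕ j))) (coefficients a w) (+ₚ-comm (coefficients a w *ₚ B) _))

  bezout : Coprime A B → 1ₚ ∈⟨A,B⟩
  bezout coprime with a +ℕ b in a+b≡n
  ... | zero  = ∈⟨A,B⟩-cong (monicOfDeg-zero (≡.subst (MonicOfDeg A) (m+n≡0⇒m≡0 a a+b≡n) monicA)) A∈⟨A,B⟩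
  ... | suc m = cramer-bezout a+b≡n (sylvester-det≉0 coprime)

module PolynomialIdentities {c ℓ} (K : Field c ℓ) where
  open Poly K
  open PolynomialRing K
  open CommutativeRing Pol-commutativeRing using () renaming (commutativeSemiring to Pol-commutativeSemiring; ring to Pol-ring)
  open RingProperties Pol-ring using () renaming (-‿distribˡ-* to -ₚ‿distribˡ-*ₚ; x≈z//y to x+y≐z⇒x≐z-y)
  open NaturalCoefficientsSolver Pol-commutativeSemiring using (solve; _:+_; _:*_; _:=_)
  open SetoidReasoning ≐-setoid

  remainder-combination : ∀ {A B} F u v q r → u *ₚ A +ₚ v *ₚ B ≐ 1ₚ → F *ₚ u ≐ q *ₚ B +ₚ r →
                          F ≐ r *ₚ A +ₚ (q *ₚ A +ₚ F *ₚ v) *ₚ B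
  remainder-combination {A} {B} F u v q r uA+vB≐1 Fu≐qB+r = begin
    F                                           ≈⟨ *ₚ-identityʳ F ⟨
    F *ₚ 1ₚ                                     ≈⟨ *ₚ-congʳ F uA+vB≐1 ⟨
    F *ₚ (u *ₚ A +ₚ v *ₚ B)                     ≈⟨ solve 5 (λ F u A v B → F :* (u :* A :+ v :* B) := (F :* u) :* A :+ (F :* v) :* B) ≐-refl F u A v B ⟩
    (F *ₚ u) *ₚ A +ₚ (F *ₚ v) *ₚ B              ≈⟨ +ₚ-cong (*ₚ-congˡ A Fu≐qB+r) ≐-refl ⟩
    (q *ₚ B +ₚ r) *ₚ A +ₚ (F *ₚ v) *ₚ B         ≈⟨ solve 6 (λ q B r A F v → (q :* B :+ r) :* A :+ (F :* v) :* B := r :* A :+ (q :* A :+ F :* v) :* B) ≐-refl q B r A F v ⟩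
    r *ₚ A +ₚ (q *ₚ A +ₚ F *ₚ v) *ₚ B          ∎

  exchange-combination : ∀ x y A B → (B +ₚ x) *ₚ A +ₚ (y +ₚ -ₚ A) *ₚ B ≐ x *ₚ A +ₚ y *ₚ B
  exchange-combination x y A B = begin
    (B +ₚ x) *ₚ A +ₚ (y +ₚ -ₚ A) *ₚ B
      ≈⟨ solve 5 (λ x y A B A⁻ → (B :+ x) :* A :+ (y :+ A⁻) :* B := (x :* A :+ y :* B) :+ (B :* A :+ A⁻ :* B)) ≐-refl x y A B (-ₚ A) ⟩
    (x *ₚ A +ₚ y *ₚ B) +ₚ (B *ₚ A +ₚ (-ₚ A) *ₚ B)
      ≈⟨ +ₚ-cong ≐-refl (≐-trans (+ₚ-cong (*ₚ-comm B A) (≐-sym (-ₚ‿distribˡ-*ₚ A B))) (-ₚ-inverseʳ (A *ₚ B))) ⟩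
    (x *ₚ A +ₚ y *ₚ B) +ₚ []                       ≈⟨ +ₚ-identityʳ _ ⟩
    x *ₚ A +ₚ y *ₚ B                               ∎

  p≐q+s⇒s≐p-q : ∀ {p q s} → p ≐ q +ₚ s → s ≐ p +ₚ -ₚ q
  p≐q+s⇒s≐p-q {p} {q} {s} p≐q+s = x+y≐z⇒x≐z-y s q p (≐-trans (+ₚ-comm s q) (≐-sym p≐q+s))

open import Data.Nat using (_+_)

lemma2p1 : ∀ {c ℓ} (K : Field c ℓ) → let open Poly K in
    ∀ (A B : Pol) (a b : ℕ) → MonicOfDeg A a → MonicOfDeg B b → Coprime A B →
    ∀ (F : Pol) (f : ℕ) → MonicOfDeg F f → a + b < f →
    ∃[ x ] ∃[ y ] (InKt≥0 x × InKt≥0 y × (F ≈ₚ x *ₚ A +ₚ y *ₚ B))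
lemma2p1 K A B a b monicA monicB coprime F f monicF a+b<f =
  B +ₚ r , y₀ +ₚ -ₚ A , inj₂ (b , monic-x) , inj₂ (f ∸ b , monic-y) ,
  coeff-≈ (≐-trans F≐rA+y₀B (≐-sym (exchange-combination r y₀ A B)))
  where
  open Poly K
  open PolynomialRing K
  open Degree K
  open Bezout K {A} {B} monicA monicB
  open PolynomialIdentities K
  open _∈⟨A,B⟩ (bezout coprime) renaming (coeffA to u; coeffB to v; combination-eq to 1≐uA+vB)
  open Division {B = B} (divide monicB (F *ₚ u))
    renaming (quotient to q; remainder to r; remainder-degree to deg-r; division-eq to Fu≐qB+r)

  y₀ : Pol
  y₀ = q *ₚ A +ₚ F *ₚ v

  F≐rA+y₀B : F ≐ r *ₚ A +ₚ y₀ *ₚ B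
  F≐rA+y₀B = remainder-combination F u v q r (≐-sym 1≐uA+vB) Fu≐qB+r

  b≤f : b ≤ f
  b≤f = ≤-trans (m≤n+m b a) (<⇒≤ a+b<f)

  monic-x : MonicOfDeg (B +ₚ r) b
  monic-x = monicOfDeg-+ₚ {B} monicB deg-r

  deg-rA : DegreeBelow (r *ₚ A) f
  deg-rA = degreeBelow-mono (≤-trans (≤-reflexive (+ℕ-comm b a)) (<⇒≤ a+b<f))
                            (degreeBelow-*ₚ b a deg-r (monicOfDeg⇒degreeBelow monicA))

  monic-y₀B : MonicOfDeg (y₀ *ₚ B) ((f ∸ b) + b)
  monic-y₀B = ≡.subst (MonicOfDeg (y₀ *ₚ B)) (≡.sym (m∸n+n≡m b≤f))
    (monicOfDeg-cong {F +ₚ -ₚ (r *ₚ A)} (≐-sym (p≐q+s⇒s≐p-q F≐rA+y₀B)) (monicOfDeg-+ₚ {F} monicF (degreeBelow--ₚ deg-rA)))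

  monic-y : MonicOfDeg (y₀ +ₚ -ₚ A) (f ∸ b)
  monic-y = monicOfDeg-+ₚ {y₀} (monicOfDeg-cancelʳ monicB {y₀} monic-y₀B)
    (degreeBelow--ₚ (degreeBelow-mono (m+n≤o⇒m≤o∸n (suc a) a+b<f) (monicOfDeg⇒degreeBelow monicA)))
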